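{- Fix a sequence of matchings and any non-negative load vector at the end of round $t_1$, and let $\mathcal{B}$ be an arbitrary subset of tokens. Then for any subset of nodes $D\subseteq V$ and any round $t_2>t_1$, $$\Pr\left[\bigwedge_{i\in\mathcal{B}}\left(w_i^{(t_2)}\in D\right)\right]\le\prod_{i\in\mathcal{B}}\mathbf{M}^{[t_1+1,t_2]}_{w_i^{(t_1)},D}=\prod_{i\in\mathcal{B}}\Pr\left[w_i^{(t_2)}\in D\right].$$
   Context: Token-based description of the discrete matching protocol on a graph $G=(V,E)$: tokens are distinguishable; if $u,v$ are matched in round $t$, all $x_u^{(t-1)}+x_v^{(t-1)}$ tokens at $u$ and $v$ are placed in an urn; with probability $1/2$ node $u$ draws $\lceil (x_u^{(t-1)}+x_v^{(t-1)})/2\rceil$ tokens uniformly at random without replacement, otherwise $\lfloor (x_u^{(t-1)}+x_v^{(t-1)})/2\rfloor$, and $v$ receives the remaining tokens; choices independent over edges and rounds; unmatched nodes keep their tokens. $w_i^{(t)}$ is the node holding token $i$ at the end of round $t$. Matching matrices have entries $1/2$ at $(u,u),(v,v),(u,v),(v,u)$ for matched pairs, $1$ on the diagonal at unmatched nodes, $0$ elsewhere; $\mathbf{M}^{[t_1,t_2]}=\prod_{s=t_1}^{t_2}\mathbf{M}^{(s)}$; $\mathbf{M}_{u,D}:=\sum_{v\in D}\mathbf{M}_{u,v}$. -}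

module Defs where

open import Data.Nat as ℕ using (ℕ; zero; suc; ⌈_/2⌉; ⌊_/2⌋)
open import Data.Nat.Combinatorics using (_C_)
open import Data.Integer using (+_)
open import Data.Fin as Fin using (Fin; toℕ)
open import Data.Fin.Subset using (Subset; _∈_)
open import Data.Fin.Subset.Properties using (_∈?_)
open import Data.Vec using (Vec; []; _∷_; lookup)
open import Data.Vec.Properties using (≡-dec)
open import Data.List using (List; []; _∷_; map; concatMap; foldr; allFin; filter)
open import Data.Rational using (ℚ; 0ℚ; 1ℚ; ½; _+_; _*_; _/_)
open import Data.Bool using (Bool; true; false; if_then_else_; _∧_; _∨_)
open import Relation.Nullary using (¬_; Dec; yes; no; does)
open import Relation.Binary.PropositionalEquality using (_≡_)

record Graph (n : ℕ) : Set₁ where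
  field
    Adj : Fin n → Fin n → Set

-- A matching of G: an involution σ on the vertices; u is unmatched iff
-- σ u ≡ u, otherwise u is matched to σ u, which must be adjacent in G.
record Matching {n : ℕ} (G : Graph n) : Set where
  field
    σ      : Fin n → Fin n
    invol  : ∀ u → σ (σ u) ≡ u
    inG    : ∀ u → ¬ (σ u ≡ u) → Graph.Adj G u (σ u)
open Matching public

Σℚ : {A : Set} → List A → (A → ℚ) → ℚ
Σℚ xs f = foldr (λ x acc → f x + acc) 0ℚ xs

Πℚ : {A : Set} → List A → (A → ℚ) → ℚ
Πℚ xs f = foldr (λ x acc → f x * acc) 1ℚ xs

𝟙 : {P : Set} → Dec P → ℚ
𝟙 (yes _) = 1ℚ
𝟙 (no _)  = 0ℚ

-- 1 / d  (with the convention 1/0 = 0; only used with d ≠ 0)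
inv : ℕ → ℚ
inv zero    = 0ℚ
inv (suc d) = + 1 / suc d

count : {A : Set} → (A → Bool) → List A → ℕ
count p xs = foldr (λ x acc → if p x then suc acc else acc) 0 xs

-- Token configurations: token i (i : Fin m) is at node lookup w i.

Config : ℕ → ℕ → Set
Config n m = Vec (Fin n) m

allConfigs : (n m : ℕ) → List (Config n m)
allConfigs n zero    = [] ∷ []
allConfigs n (suc m) =
  concatMap (λ w → map (λ u → u ∷ w) (allFin n)) (allConfigs n m)

-- For a matched pair {u,v} holding s tokens in total: with prob. 1/2 node u
-- draws ⌈s/2⌉ tokens uniformly at random (each such set has prob.
-- 1/(s C ⌈s/2⌉)), otherwise ⌊s/2⌋ tokens.  Probability that u ends up with
-- one given set of exactly k of the s tokens:
pairProb : ℕ → ℕ → ℚ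
pairProb s k =
    ½ * (𝟙 (k ℕ.≟ ⌈ s /2⌉) * inv (s C ⌈ s /2⌉))
  + ½ * (𝟙 (k ℕ.≟ ⌊ s /2⌋) * inv (s C ⌊ s /2⌋))

module _ {n : ℕ} {G : Graph n} (M : Matching G) where

  legal : ∀ {m} → Config n m → Config n m → Fin m → Bool
  legal w w' i with σ M (lookup w i) Fin.≟ lookup w i
  ... | yes _ = does (lookup w' i Fin.≟ lookup w i)
  ... | no  _ = does (lookup w' i Fin.≟ lookup w i)
              ∨ does (lookup w' i Fin.≟ σ M (lookup w i))

  allLegal : ∀ {m} → Config n m → Config n m → Bool
  allLegal {m} w w' = foldr (λ i b → legal w w' i ∧ b) true (allFin m)

  -- factor of the matched pair {u, σ u}, counted once (for toℕ u < toℕ (σ u))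
  pairFactor : ∀ {m} → Config n m → Config n m → Fin n → ℚ
  pairFactor {m} w w' u with toℕ u ℕ.<? toℕ (σ M u)
  ... | no  _ = 1ℚ
  ... | yes _ =
    pairProb
      (count (λ i → does (lookup w i Fin.≟ u) ∨ does (lookup w i Fin.≟ σ M u)) (allFin m))
      (count (λ i → (does (lookup w i Fin.≟ u) ∨ does (lookup w i Fin.≟ σ M u))
                    ∧ does (lookup w' i Fin.≟ u)) (allFin m))

  -- transition probability  Pr[ config after the round = w' | config before = w ]
  step : ∀ {m} → Config n m → Config n m → ℚ
  step w w' =
    (if allLegal w w' then 1ℚ else 0ℚ) * Πℚ (allFin n) (pairFactor w w')

module _ {n : ℕ} {G : Graph n} (M : ℕ → Matching G) where

  -- run M t₁ k w w' = Pr[ w^(t₁+k) = w' | w^(t₁) = w ]  (rounds t₁+1, …, t₁+k)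
  run : ∀ {m} → ℕ → ℕ → Config n m → Config n m → ℚ
  run t₁ zero    w w' = 𝟙 (≡-dec Fin._≟_ w w')
  run {m} t₁ (suc k) w w' =
    Σℚ (allConfigs n m) (λ w'' → run t₁ k w w'' * step (M (suc (t₁ ℕ.+ k))) w'' w')

  PrAllIn : ∀ {m} → ℕ → ℕ → Config n m → Subset m → Subset n → ℚ
  PrAllIn {m} t₁ t₂ w B D =
    Σℚ (allConfigs n m) (λ w' →
      run t₁ (t₂ ℕ.∸ t₁) w w' *
      Πℚ (allFin m) (λ i → if does (i ∈? B) then 𝟙 (lookup w' i ∈? D) else 1ℚ))

  PrIn : ∀ {m} → ℕ → ℕ → Config n m → Fin m → Subset n → ℚ
  PrIn {m} t₁ t₂ w i D =
    Σℚ (allConfigs n m) (λ w' → run t₁ (t₂ ℕ.∸ t₁) w w' * 𝟙 (lookup w' i ∈? D))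

Matrix : ℕ → Set
Matrix n = Fin n → Fin n → ℚ

matMatrix : ∀ {n} {G : Graph n} → Matching G → Matrix n
matMatrix M u v with σ M u Fin.≟ u
... | yes _ = 𝟙 (u Fin.≟ v)
... | no  _ = if does (v Fin.≟ u) ∨ does (v Fin.≟ σ M u) then ½ else 0ℚ

idMatrix : ∀ {n} → Matrix n
idMatrix u v = 𝟙 (u Fin.≟ v)

_⊗_ : ∀ {n} → Matrix n → Matrix n → Matrix n
_⊗_ {n} A B u v = Σℚ (allFin n) (λ x → A u x * B x v)

-- Mprod M t₁ k = M^(t₁+1) M^(t₁+2) ⋯ M^(t₁+k)
Mprod : ∀ {n} {G : Graph n} → (ℕ → Matching G) → ℕ → ℕ → Matrix n
Mprod M t₁ zero    = idMatrix
Mprod M t₁ (suc k) = Mprod M t₁ k ⊗ matMatrix (M (suc (t₁ ℕ.+ k)))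

Minterval : ∀ {n} {G : Graph n} → (ℕ → Matching G) → ℕ → ℕ → Matrix n
Minterval M t₁ t₂ = Mprod M t₁ (t₂ ℕ.∸ t₁)

rowSum : ∀ {n} → Matrix n → Fin n → Subset n → ℚ
rowSum {n} A u D = Σℚ (allFin n) (λ v → if does (v ∈? D) then A u v else 0ℚ)

ΠB : ∀ {m} → Subset m → (Fin m → ℚ) → ℚ
ΠB {m} B f = Πℚ (allFin m) (λ i → if does (i ∈? B) then f i else 1ℚ)

module Submission where

-- Fix a node weight g ≥ 0 (at the end g is the indicator of D) and a set β of
-- tracked tokens.  The heart of the proof is the ONE-ROUND PRODUCT BOUND:
-- after one round with matching N, started from configuration w,
--     E[ ∏_{i∈β} g(w'_i) ]  ≤  ∏_{i∈β} (N g)(w_i),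
-- with equality when β is a single token.  Iterating it along the
-- Chapman–Kolmogorov recursion defining 'run' gives the bound with the matrix
-- product M^[t₁+1,t₂] in place of N, which for g = 𝟙_D is the row sum in the
-- statement; the single-token equality gives the second conjunct.
--
-- The one-round expectation factorises over matched pairs {u, σ u}.  If the
-- pair holds k tracked and r untracked tokens, its factor is the "split sum"
-- Ψ_{a,b}(pairProb (k+r)) k r (a = g u, b = g (σ u)), and the whole lemma
-- rests on the BALANCED SPLIT INEQUALITY  Ψ_{a,b}(pairProb (k+r)) k r ≤ ((a+b)/2)^k
-- (equality for k ≤ 1).  It is proved for the uniform split of 2t tokens by
-- induction on t, using two "size-weighting" identities of Ψ; an odd number
-- of tokens reduces to the even case.

open import Defs
open import Data.Nat using (ℕ; _<_)
open import Data.Fin.Subset using (Subset)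
open import Data.Vec using (lookup)
open import Data.Rational using (_≤_)
open import Data.Product using (_×_)
open import Relation.Binary.PropositionalEquality using (_≡_)

module RationalFacts where

  open import Data.Nat as ℕ using (ℕ; zero; suc)
  import Data.Nat.Properties as ℕP
  open import Data.Integer as ℤ using (+_)
  import Data.Integer.Properties as ℤP
  open import Data.Rational hiding (_<_)
  open import Data.Rational using () renaming (_<_ to _<ℚ_)
  open import Data.Rational.Properties
  import Data.Rational.Unnormalised as U
  import Data.Rational.Unnormalised.Properties as UP
  open import Relation.Binary.PropositionalEquality
  open import Relation.Nullary using (Dec; yes; no)
  open import Data.Sum using (inj₁; inj₂)
  open import Data.Rational.Solver
  open +-*-Solver

  ι : ℕ → ℚ
  ι n = + n / 1

  ι-suc : ∀ n → ι (suc n) ≡ 1ℚ + ι n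
  ι-suc n = toℚᵘ-injective (UP.≃-trans (toℚᵘ-fromℚᵘ (U.mkℚᵘ (+ suc n) 0))
     (UP.≃-sym (UP.≃-trans (toℚᵘ-homo-+ 1ℚ (ι n))
       (UP.≃-trans (UP.+-cong (toℚᵘ-fromℚᵘ (U.mkℚᵘ (+ 1) 0)) (toℚᵘ-fromℚᵘ (U.mkℚᵘ (+ n) 0))) unnormalised))))
    where
    unnormalised : U.mkℚᵘ (+ 1) 0 U.+ U.mkℚᵘ (+ n) 0 U.≃ U.mkℚᵘ (+ suc n) 0
    unnormalised = U.*≡* (trans (ℤP.*-identityʳ _) (trans (cong₂ ℤ._+_ (ℤP.*-identityʳ (+ 1)) (ℤP.*-identityʳ (+ n))) (sym (ℤP.*-identityʳ (+ suc n)))))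

  ι-+ : ∀ m n → ι (m ℕ.+ n) ≡ ι m + ι n
  ι-+ zero n = sym (+-identityˡ (ι n))
  ι-+ (suc m) n = trans (ι-suc (m ℕ.+ n)) (trans (cong (λ z → 1ℚ + z) (ι-+ m n))
     (trans (sym (+-assoc 1ℚ (ι m) (ι n))) (cong (_+ ι n) (sym (ι-suc m)))))

  ι-* : ∀ m n → ι (m ℕ.* n) ≡ ι m * ι n
  ι-* zero n = sym (*-zeroˡ (ι n))
  ι-* (suc m) n = trans (ι-+ n (m ℕ.* n)) (trans (cong (λ z → ι n + z) (ι-* m n))
    (trans (cong (_+ ι m * ι n) (sym (*-identityˡ (ι n))))
     (trans (sym (*-distribʳ-+ (ι n) 1ℚ (ι m))) (cong (_* ι n) (sym (ι-suc m))))))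

  0≤ι : ∀ n → 0ℚ ≤ ι n
  0≤ι n = nonNegative⁻¹ (ι n) {{normalize-nonNeg n 1}}

  0<ι : ∀ n → 0ℚ <ℚ ι (suc n)
  0<ι n = positive⁻¹ (ι (suc n)) {{normalize-pos (suc n) 1}}

  *-mono-nonneg : ∀ {a b c d} → 0ℚ ≤ b → 0ℚ ≤ c → a ≤ b → c ≤ d → a * c ≤ b * d
  *-mono-nonneg {a} {b} {c} {d} 0≤b 0≤c a≤b c≤d =
    ≤-trans (*-monoʳ-≤-nonNeg c {{nonNegative 0≤c}} a≤b) (*-monoˡ-≤-nonNeg b {{nonNegative 0≤b}} c≤d)

  *-monoˡ-nonneg : ∀ {a c d} → 0ℚ ≤ a → c ≤ d → a * c ≤ a * d
  *-monoˡ-nonneg {a} 0≤a c≤d = *-monoˡ-≤-nonNeg a {{nonNegative 0≤a}} c≤d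

  *-nonneg : ∀ {a b} → 0ℚ ≤ a → 0ℚ ≤ b → 0ℚ ≤ a * b
  *-nonneg {a} {b} 0≤a 0≤b = ≤-trans (≤-reflexive (sym (*-zeroˡ b))) (*-mono-nonneg 0≤a 0≤b 0≤a ≤-refl)

  +-nonneg : ∀ {a b} → 0ℚ ≤ a → 0ℚ ≤ b → 0ℚ ≤ a + b
  +-nonneg 0≤a 0≤b = +-mono-≤ 0≤a 0≤b

  *-cancelˡ-pos : ∀ {c x y} → 0ℚ <ℚ c → c * x ≤ c * y → x ≤ y
  *-cancelˡ-pos {c} 0<c h = *-cancelˡ-≤-pos c {{positive 0<c}} h

  *-cancelˡ-pos-≡ : ∀ {c x y} → 0ℚ <ℚ c → c * x ≡ c * y → x ≡ y
  *-cancelˡ-pos-≡ 0<c h = ≤-antisym (*-cancelˡ-pos 0<c (≤-reflexive h)) (*-cancelˡ-pos 0<c (≤-reflexive (sym h)))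

  square-nonneg : ∀ x → 0ℚ ≤ x * x
  square-nonneg x with ≤-total 0ℚ x
  ... | inj₁ 0≤x = *-nonneg 0≤x 0≤x
  ... | inj₂ x≤0 = nonNegative⁻¹ (x * x) {{nonPos*nonPos⇒nonPos x {{nonPositive x≤0}} x {{nonPositive x≤0}}}}

  -- AM–GM for two factors:  a b ≤ ((a+b)/2)²,  since the difference is ((a-b)/2)².
  am-gm : ∀ a b → a * b ≤ (½ * (a + b)) * (½ * (a + b))
  am-gm a b = ≤-trans (≤-reflexive (sym (+-identityʳ (a * b))))
      (≤-trans (+-monoʳ-≤ (a * b) (square-nonneg (½ * (a - b))))
        (≤-reflexive (solve 2 (λ a b → a :* b :+ (con ½ :* (a :- b)) :* (con ½ :* (a :- b)) := (con ½ :* (a :+ b)) :* (con ½ :* (a :+ b))) refl a b)))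

  pow : ℚ → ℕ → ℚ
  pow x zero = 1ℚ
  pow x (suc n) = x * pow x n

  pow-nonneg : ∀ {x} n → 0ℚ ≤ x → 0ℚ ≤ pow x n
  pow-nonneg zero 0≤x = *≤* (ℤ.+≤+ ℕ.z≤n)
  pow-nonneg (suc n) 0≤x = *-nonneg 0≤x (pow-nonneg n 0≤x)

  0≤𝟙 : ∀ {P : Set} (d : Dec P) → 0ℚ ≤ 𝟙 d
  0≤𝟙 (yes _) = nonNegative⁻¹ 1ℚ
  0≤𝟙 (no _) = ≤-refl

  0≤inv : ∀ n → 0ℚ ≤ inv n
  0≤inv zero = ≤-refl
  0≤inv (suc n) = nonNegative⁻¹ (inv (suc n)) {{normalize-nonNeg 1 (suc n)}}

  ι*inv : ∀ d → ι (suc d) * inv (suc d) ≡ 1ℚ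
  ι*inv d = toℚᵘ-injective (UP.≃-trans (toℚᵘ-homo-* (ι (suc d)) (inv (suc d)))
     (UP.≃-trans (UP.*-cong (toℚᵘ-fromℚᵘ (U.mkℚᵘ (+ suc d) 0)) (toℚᵘ-fromℚᵘ (U.mkℚᵘ (+ 1) d)))
     (UP.≃-trans (UP.*-comm (U.mkℚᵘ (+ suc d) 0) (U.mkℚᵘ (+ 1) d)) unnormalised)))
    where
    unnormalised : U.mkℚᵘ (+ 1) d U.* U.mkℚᵘ (+ suc d) 0 U.≃ U.mkℚᵘ (+ 1) 0
    unnormalised = U.*≡* (trans (ℤP.*-identityʳ _) (trans (ℤP.*-identityˡ (+ suc d)) (sym (trans (ℤP.*-identityˡ _) (cong +_ (ℕP.*-identityʳ (suc d)))))))

  inv-cross : ∀ p q A B → 0 ℕ.< A → 0 ℕ.< B → p ℕ.* B ≡ q ℕ.* A → ι p * inv A ≡ ι q * inv B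
  inv-cross p q (suc A) (suc B) _ _ eq = begin
    ι p * inv (suc A)                                   ≡⟨ solve 2 (λ x y → x :* y := (x :* y) :* con 1ℚ) refl (ι p) (inv (suc A)) ⟩
    (ι p * inv (suc A)) * 1ℚ                            ≡⟨ cong ((ι p * inv (suc A)) *_) (sym (ι*inv B)) ⟩
    (ι p * inv (suc A)) * (ι (suc B) * inv (suc B))     ≡⟨ solve 4 (λ x y z w → (x :* y) :* (z :* w) := (x :* z) :* y :* w) refl (ι p) (inv (suc A)) (ι (suc B)) (inv (suc B)) ⟩
    ι p * ι (suc B) * inv (suc A) * inv (suc B)         ≡⟨ cong (λ z → z * inv (suc A) * inv (suc B)) (trans (sym (ι-* p (suc B))) (trans (cong ι eq) (ι-* q (suc A)))) ⟩
    ι q * ι (suc A) * inv (suc A) * inv (suc B)         ≡⟨ solve 4 (λ x y z w → x :* y :* z :* w := (x :* w) :* (y :* z)) refl (ι q) (ι (suc A)) (inv (suc A)) (inv (suc B)) ⟩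
    (ι q * inv (suc B)) * (ι (suc A) * inv (suc A))     ≡⟨ cong ((ι q * inv (suc B)) *_) (ι*inv A) ⟩
    (ι q * inv (suc B)) * 1ℚ                            ≡⟨ *-identityʳ _ ⟩
    ι q * inv (suc B) ∎
    where open ≡-Reasoning

module FiniteSums where

  open import Data.Nat using (zero; suc)
  open import Data.Fin as Fin using (Fin; zero; suc)
  open import Data.Vec using ([]; _∷_)
  open import Data.Vec.Properties using (≡-dec)
  import Data.Vec.Properties as VP
  import Data.Fin.Properties as FP
  open import Data.List using (List; []; _∷_; map; concatMap; foldr; allFin; tabulate; _++_)
  open import Data.Rational hiding (_<_)
  open import Data.Rational.Properties
  open import Data.Bool using (Bool; true; false; if_then_else_)
  open import Relation.Nullary using (Dec; yes; no; does)
  open import Relation.Nullary.Decidable using (does-⇔)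
  open import Relation.Binary.PropositionalEquality
  open import Function using (_∘_; mk⇔)
  open import Data.Empty using (⊥-elim)
  open import Data.Rational.Solver
  open +-*-Solver
  open RationalFacts

  private variable A B : Set

  indicator : Bool → ℚ
  indicator b = if b then 1ℚ else 0ℚ

  𝟙-does : ∀ {P : Set} (d : Dec P) → 𝟙 d ≡ indicator (does d)
  𝟙-does (yes _) = refl
  𝟙-does (no _) = refl

  does≡ : ∀ {P Q : Set} (d1 : Dec P) (d2 : Dec Q) → (P → Q) → (Q → P) → does d1 ≡ does d2
  does≡ d1 d2 f g = does-⇔ (mk⇔ f g) d1 d2

  𝟙≡ : ∀ {P Q : Set} (d1 : Dec P) (d2 : Dec Q) → (P → Q) → (Q → P) → 𝟙 d1 ≡ 𝟙 d2
  𝟙≡ d1 d2 f g = trans (𝟙-does d1) (trans (cong indicator (does≡ d1 d2 f g)) (sym (𝟙-does d2)))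

  if-true : ∀ {X : Set} {b} {x y : X} → b ≡ true → (if b then x else y) ≡ x
  if-true refl = refl

  if-false : ∀ {X : Set} {b} {x y : X} → b ≡ false → (if b then x else y) ≡ y
  if-false refl = refl

  Σ-cong : ∀ (xs : List A) {f g : A → ℚ} → (∀ x → f x ≡ g x) → Σℚ xs f ≡ Σℚ xs g
  Σ-cong [] h = refl
  Σ-cong (x ∷ xs) h = cong₂ _+_ (h x) (Σ-cong xs h)

  Π-cong : ∀ (xs : List A) {f g : A → ℚ} → (∀ x → f x ≡ g x) → Πℚ xs f ≡ Πℚ xs g
  Π-cong [] h = refl
  Π-cong (x ∷ xs) h = cong₂ _*_ (h x) (Π-cong xs h)

  Σ-++ : ∀ (xs ys : List A) f → Σℚ (xs ++ ys) f ≡ Σℚ xs f + Σℚ ys f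
  Σ-++ [] ys f = sym (+-identityˡ (Σℚ ys f))
  Σ-++ (x ∷ xs) ys f = trans (cong (f x +_) (Σ-++ xs ys f)) (sym (+-assoc (f x) (Σℚ xs f) (Σℚ ys f)))

  Σ-map : ∀ (g : A → B) (xs : List A) f → Σℚ (map g xs) f ≡ Σℚ xs (f ∘ g)
  Σ-map g [] f = refl
  Σ-map g (x ∷ xs) f = cong (f (g x) +_) (Σ-map g xs f)

  Σ-concatMap : ∀ (h : A → List B) (xs : List A) f → Σℚ (concatMap h xs) f ≡ Σℚ xs (λ x → Σℚ (h x) f)
  Σ-concatMap h [] f = refl
  Σ-concatMap h (x ∷ xs) f = trans (Σ-++ (h x) (concatMap h xs) f) (cong (Σℚ (h x) f +_) (Σ-concatMap h xs f))

  Σ-+ : ∀ (xs : List A) f g → Σℚ xs (λ x → f x + g x) ≡ Σℚ xs f + Σℚ xs g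
  Σ-+ [] f g = refl
  Σ-+ (x ∷ xs) f g = trans (cong (f x + g x +_) (Σ-+ xs f g))
    (solve 4 (λ a b c d → a :+ b :+ (c :+ d) := a :+ c :+ (b :+ d)) refl (f x) (g x) (Σℚ xs f) (Σℚ xs g))

  Σ-scaleˡ : ∀ (xs : List A) c f → Σℚ xs (λ x → c * f x) ≡ c * Σℚ xs f
  Σ-scaleˡ [] c f = sym (*-zeroʳ c)
  Σ-scaleˡ (x ∷ xs) c f = trans (cong (c * f x +_) (Σ-scaleˡ xs c f)) (sym (*-distribˡ-+ c (f x) _))

  Σ-scaleʳ : ∀ (xs : List A) c f → Σℚ xs (λ x → f x * c) ≡ Σℚ xs f * c
  Σ-scaleʳ xs c f = trans (Σ-cong xs (λ x → *-comm (f x) c)) (trans (Σ-scaleˡ xs c f) (*-comm c _))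

  Σ-zero : ∀ (xs : List A) → Σℚ xs (λ _ → 0ℚ) ≡ 0ℚ
  Σ-zero [] = refl
  Σ-zero (x ∷ xs) = trans (+-identityˡ _) (Σ-zero xs)

  Σ-swap : ∀ (xs : List A) (ys : List B) (f : A → B → ℚ) → Σℚ xs (λ x → Σℚ ys (λ y → f x y)) ≡ Σℚ ys (λ y → Σℚ xs (λ x → f x y))
  Σ-swap [] ys f = sym (Σ-zero ys)
  Σ-swap (x ∷ xs) ys f = trans (cong (Σℚ ys (f x) +_) (Σ-swap xs ys f)) (sym (Σ-+ ys (f x) (λ y → Σℚ xs (λ x' → f x' y))))

  Σ-mono : ∀ (xs : List A) {f g : A → ℚ} → (∀ x → f x ≤ g x) → Σℚ xs f ≤ Σℚ xs g
  Σ-mono [] h = ≤-refl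
  Σ-mono (x ∷ xs) h = +-mono-≤ (h x) (Σ-mono xs h)

  Σ-nonneg : ∀ (xs : List A) {f : A → ℚ} → (∀ x → 0ℚ ≤ f x) → 0ℚ ≤ Σℚ xs f
  Σ-nonneg [] h = ≤-refl
  Σ-nonneg (x ∷ xs) h = +-nonneg (h x) (Σ-nonneg xs h)

  Π-nonneg : ∀ (xs : List A) {f : A → ℚ} → (∀ x → 0ℚ ≤ f x) → 0ℚ ≤ Πℚ xs f
  Π-nonneg [] h = nonNegative⁻¹ 1ℚ
  Π-nonneg (x ∷ xs) h = *-nonneg (h x) (Π-nonneg xs h)

  Π-mono : ∀ (xs : List A) {f g : A → ℚ} → (∀ x → 0ℚ ≤ f x) → (∀ x → f x ≤ g x) → Πℚ xs f ≤ Πℚ xs g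
  Π-mono [] h0 h = ≤-refl
  Π-mono (x ∷ xs) h0 h = *-mono-nonneg (≤-trans (h0 x) (h x)) (Π-nonneg xs h0) (h x) (Π-mono xs h0 h)

  Π-ones : ∀ (xs : List A) → Πℚ xs (λ _ → 1ℚ) ≡ 1ℚ
  Π-ones [] = refl
  Π-ones (x ∷ xs) = trans (*-identityˡ _) (Π-ones xs)

  -- allFin (suc m) is  zero ∷ map suc (allFin m), seen through any fold
  foldr-tabulate : ∀ {m} (h : A → B → B) e (f : Fin m → A) → foldr h e (tabulate f) ≡ foldr (λ i → h (f i)) e (allFin m)
  foldr-tabulate {m = zero} h e f = refl
  foldr-tabulate {m = suc m} h e f = cong (h (f zero)) (trans (foldr-tabulate h e (f ∘ suc)) (sym (foldr-tabulate (λ i → h (f i)) e suc)))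

  foldr-allFin : ∀ {m} (h : Fin (suc m) → B → B) e → foldr h e (allFin (suc m)) ≡ h zero (foldr (h ∘ suc) e (allFin m))
  foldr-allFin h e = cong (h zero) (foldr-tabulate h e suc)

  Σ-suc : ∀ {m} (f : Fin (suc m) → ℚ) → Σℚ (allFin (suc m)) f ≡ f zero + Σℚ (allFin m) (f ∘ suc)
  Σ-suc f = foldr-allFin (λ x acc → f x + acc) 0ℚ

  Π-suc : ∀ {m} (f : Fin (suc m) → ℚ) → Πℚ (allFin (suc m)) f ≡ f zero * Πℚ (allFin m) (f ∘ suc)
  Π-suc f = foldr-allFin (λ x acc → f x * acc) 1ℚ

  Σ-delta : ∀ {n} (u : Fin n) (g : Fin n → ℚ) → Σℚ (allFin n) (λ v → 𝟙 (u Fin.≟ v) * g v) ≡ g u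
  Σ-delta {suc n} zero g = trans (Σ-suc (λ v → 𝟙 (zero Fin.≟ v) * g v))
    (trans (cong₂ _+_ (*-identityˡ (g zero)) (trans (Σ-cong (allFin n) (λ v → *-zeroˡ (g (suc v)))) (Σ-zero (allFin n)))) (+-identityʳ (g zero)))
  Σ-delta {suc n} (suc u) g = trans (Σ-suc (λ v → 𝟙 (suc u Fin.≟ v) * g v))
    (trans (cong₂ _+_ (*-zeroˡ (g zero)) (trans (Σ-cong (allFin n) (λ v → cong (_* g (suc v)) (𝟙≡ (suc u Fin.≟ suc v) (u Fin.≟ v) FP.suc-injective (cong suc)))) (Σ-delta u (g ∘ suc))))
       (+-identityˡ (g (suc u))))

  Π-delta : ∀ {m} (i : Fin m) (h : Fin m → ℚ) → Πℚ (allFin m) (λ j → if does (j Fin.≟ i) then h j else 1ℚ) ≡ h i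
  Π-delta {suc m} zero h = trans (Π-suc (λ j → if does (j Fin.≟ zero) then h j else 1ℚ)) (trans (cong (h zero *_) (Π-ones (allFin m))) (*-identityʳ (h zero)))
  Π-delta {suc m} (suc i) h = trans (Π-suc (λ j → if does (j Fin.≟ suc i) then h j else 1ℚ)) (trans (*-identityˡ (Πℚ (allFin m) (λ j → if does (suc j Fin.≟ suc i) then h (suc j) else 1ℚ)))
     (trans (Π-cong (allFin m) (λ j → cong (λ b → if b then h (suc j) else 1ℚ) (does≡ (suc j Fin.≟ suc i) (j Fin.≟ i) FP.suc-injective (cong suc))))
       (Π-delta i (h ∘ suc))))

  Π-extract : ∀ {n} (r : Fin n) (f : Fin n → ℚ) → Πℚ (allFin n) f ≡ f r * Πℚ (allFin n) (λ u → if does (u Fin.≟ r) then 1ℚ else f u)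
  Π-extract {suc n} zero f = trans (Π-suc f) (cong (f zero *_) (sym (trans (Π-suc (λ u → if does (u Fin.≟ zero) then 1ℚ else f u)) (*-identityˡ (Πℚ (allFin n) (f ∘ suc))))))
  Π-extract {suc n} (suc r) f = begin
      Πℚ (allFin (suc n)) f
        ≡⟨ Π-suc f ⟩
      f zero * Πℚ (allFin n) (f ∘ suc)
        ≡⟨ cong (f zero *_) (Π-extract r (f ∘ suc)) ⟩
      f zero * (f (suc r) * Rest)
        ≡⟨ solve 3 (λ a b c → a :* (b :* c) := b :* (a :* c)) refl (f zero) (f (suc r)) Rest ⟩
      f (suc r) * (f zero * Rest)
        ≡⟨ cong (λ z → f (suc r) * (f zero * z)) (Π-cong (allFin n) (λ u → cong (λ b → if b then 1ℚ else f (suc u)) (does≡ (u Fin.≟ r) (suc u Fin.≟ suc r) (cong suc) FP.suc-injective))) ⟩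
      f (suc r) * (f zero * Πℚ (allFin n) (λ u → if does (suc u Fin.≟ suc r) then 1ℚ else f (suc u)))
        ≡⟨ cong (f (suc r) *_) (sym (Π-suc (λ u → if does (u Fin.≟ suc r) then 1ℚ else f u))) ⟩
      f (suc r) * Πℚ (allFin (suc n)) (λ u → if does (u Fin.≟ suc r) then 1ℚ else f u) ∎
    where
    open ≡-Reasoning
    Rest : ℚ
    Rest = Πℚ (allFin n) (λ u → if does (u Fin.≟ r) then 1ℚ else f (suc u))

  Σ-allConfigs-suc : ∀ n m (f : Config n (suc m) → ℚ) → Σℚ (allConfigs n (suc m)) f ≡ Σℚ (allConfigs n m) (λ w → Σℚ (allFin n) (λ u → f (u ∷ w)))
  Σ-allConfigs-suc n m f = trans (Σ-concatMap (λ w → map (λ u → u ∷ w) (allFin n)) (allConfigs n m) f)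
     (Σ-cong (allConfigs n m) (λ w → Σ-map (λ u → u ∷ w) (allFin n) f))

  Σ-allConfigs-delta : ∀ n m (w : Config n m) (F : Config n m → ℚ) → Σℚ (allConfigs n m) (λ w' → 𝟙 (≡-dec Fin._≟_ w w') * F w') ≡ F w
  Σ-allConfigs-delta n zero [] F = trans (cong (_+ 0ℚ) (*-identityˡ (F []))) (+-identityʳ (F []))
  Σ-allConfigs-delta n (suc m) (x ∷ w) F = begin
      Σℚ (allConfigs n (suc m)) (λ w' → 𝟙 (≡-dec Fin._≟_ (x ∷ w) w') * F w')
        ≡⟨ Σ-allConfigs-suc n m (λ w' → 𝟙 (≡-dec Fin._≟_ (x ∷ w) w') * F w') ⟩
      Σℚ (allConfigs n m) (λ w' → Σℚ (allFin n) (λ u → 𝟙 (≡-dec Fin._≟_ (x ∷ w) (u ∷ w')) * F (u ∷ w')))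
        ≡⟨ Σ-cong (allConfigs n m) (λ w' → Σ-cong (allFin n) (λ u → split w' u)) ⟩
      Σℚ (allConfigs n m) (λ w' → Σℚ (allFin n) (λ u → 𝟙 (x Fin.≟ u) * (𝟙 (≡-dec Fin._≟_ w w') * F (u ∷ w'))))
        ≡⟨ Σ-cong (allConfigs n m) (λ w' → Σ-delta x (λ u → 𝟙 (≡-dec Fin._≟_ w w') * F (u ∷ w'))) ⟩
      Σℚ (allConfigs n m) (λ w' → 𝟙 (≡-dec Fin._≟_ w w') * F (x ∷ w'))
        ≡⟨ Σ-allConfigs-delta n m w (λ w' → F (x ∷ w')) ⟩
      F (x ∷ w) ∎
    where
    open ≡-Reasoning
    split : ∀ w' u → 𝟙 (≡-dec Fin._≟_ (x ∷ w) (u ∷ w')) * F (u ∷ w') ≡ 𝟙 (x Fin.≟ u) * (𝟙 (≡-dec Fin._≟_ w w') * F (u ∷ w'))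
    split w' u with x Fin.≟ u | ≡-dec Fin._≟_ w w' | ≡-dec Fin._≟_ (x ∷ w) (u ∷ w')
    ... | yes refl | yes refl | yes _ = trans (*-identityˡ (F (u ∷ w'))) (sym (trans (*-identityˡ (1ℚ * F (u ∷ w'))) (*-identityˡ (F (u ∷ w')))))
    ... | yes refl | yes refl | no ¬p = ⊥-elim (¬p refl)
    ... | no ¬p | _ | yes q = ⊥-elim (¬p (VP.∷-injectiveˡ q))
    ... | _ | no ¬p | yes q = ⊥-elim (¬p (VP.∷-injectiveʳ q))
    ... | yes _ | no _ | no _ = trans (*-zeroˡ (F (u ∷ w'))) (sym (trans (*-identityˡ (0ℚ * F (u ∷ w'))) (*-zeroˡ (F (u ∷ w')))))
    ... | no _ | d | no _ = trans (*-zeroˡ (F (u ∷ w'))) (sym (*-zeroˡ (𝟙 d * F (u ∷ w'))))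

module Binomials where

  open import Data.Nat hiding (_≤_)
  open import Data.Nat using () renaming (_≤_ to _≤ℕ_)
  open import Data.Nat.Properties
  open import Data.Nat.Combinatorics
  open import Relation.Binary.PropositionalEquality
  open import Data.Nat.Solver
  open +-*-Solver

  C-absorption : ∀ n k → suc k * (suc n C suc k) ≡ suc n * (n C k)
  C-absorption zero zero = refl
  C-absorption zero (suc k) = *-zeroʳ (suc (suc k))
  C-absorption (suc n) zero = trans (+-identityʳ _) (trans (nC1≡n (suc (suc n))) (sym (*-identityʳ (suc (suc n)))))
  C-absorption (suc n) (suc k) = begin
      suc (suc k) * (suc (suc n) C suc (suc k))
        ≡⟨ cong (suc (suc k) *_) (sym (nCk+nC[k+1]≡[n+1]C[k+1] (suc n) (suc k))) ⟩
      suc (suc k) * (A + B)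
        ≡⟨ solve 3 (λ k A B → (con 2 :+ k) :* (A :+ B) := A :+ (con 1 :+ k) :* A :+ (con 2 :+ k) :* B) refl k A B ⟩
      A + suc k * A + suc (suc k) * B
        ≡⟨ cong₂ (λ u v → A + u + v) (C-absorption n k) (C-absorption n (suc k)) ⟩
      A + suc n * (n C k) + suc n * (n C suc k)
        ≡⟨ solve 4 (λ n A c d → A :+ (con 1 :+ n) :* c :+ (con 1 :+ n) :* d := A :+ (con 1 :+ n) :* (c :+ d)) refl n A (n C k) (n C suc k) ⟩
      A + suc n * (n C k + n C suc k)
        ≡⟨ cong (λ z → A + suc n * z) (nCk+nC[k+1]≡[n+1]C[k+1] n k) ⟩
      suc (suc n) * A ∎
    where
    open ≡-Reasoning
    A : ℕ
    A = suc n C suc k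
    B : ℕ
    B = suc n C suc (suc k)

  C-pos : ∀ {n k} → k ≤ℕ n → 0 < n C k
  C-pos {n} {zero} _ = ≤-reflexive (sym (trans (nCk≡nC[n∸k] {k = 0} {n = n} z≤n) (nCn≡1 n)))
  C-pos {suc n} {suc k} (s≤s k≤n) = <-≤-trans (C-pos k≤n) (≤-trans (m≤m+n (n C k) (n C suc k)) (≤-reflexive (nCk+nC[k+1]≡[n+1]C[k+1] n k)))

  double-suc : ∀ t → suc t + suc t ≡ suc (suc (t + t))
  double-suc t = cong suc (+-suc t t)

  C-odd-sym : ∀ t → suc (t + t) C t ≡ suc (t + t) C suc t
  C-odd-sym t = trans (nCk≡nC[n∸k] (≤-trans (m≤m+n t t) (n≤1+n _))) (cong (suc (t + t) C_) odd∸t)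
    where
    odd∸t : suc (t + t) ∸ t ≡ suc t
    odd∸t = trans (+-∸-assoc 1 (m≤m+n t t)) (cong suc (m+n∸m≡n t t))

  central-C-double : ∀ t → (suc t + suc t) C suc t ≡ 2 * (suc (t + t) C suc t)
  central-C-double t = begin
      (suc t + suc t) C suc t
        ≡⟨ cong (_C suc t) (double-suc t) ⟩
      suc (suc (t + t)) C suc t
        ≡⟨ sym (nCk+nC[k+1]≡[n+1]C[k+1] (suc (t + t)) t) ⟩
      suc (t + t) C t + suc (t + t) C suc t
        ≡⟨ cong (_+ (suc (t + t) C suc t)) (C-odd-sym t) ⟩
      suc (t + t) C suc t + suc (t + t) C suc t
        ≡⟨ cong (suc (t + t) C suc t +_) (sym (+-identityʳ _)) ⟩
      2 * (suc (t + t) C suc t) ∎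
    where open ≡-Reasoning

  central-C-ratio : ∀ t → suc t * ((suc t + suc t) C suc t) ≡ 2 * suc (t + t) * ((t + t) C t)
  central-C-ratio t = begin
      suc t * ((suc t + suc t) C suc t)
        ≡⟨ cong (suc t *_) (central-C-double t) ⟩
      suc t * (2 * (suc (t + t) C suc t))
        ≡⟨ solve 2 (λ t x → (con 1 :+ t) :* (con 2 :* x) := con 2 :* ((con 1 :+ t) :* x)) refl t (suc (t + t) C suc t) ⟩
      2 * (suc t * (suc (t + t) C suc t))
        ≡⟨ cong (2 *_) (C-absorption (t + t) t) ⟩
      2 * (suc (t + t) * ((t + t) C t))
        ≡⟨ sym (*-assoc 2 (suc (t + t)) _) ⟩
      2 * suc (t + t) * ((t + t) C t) ∎
    where open ≡-Reasoning

  falling-square : ∀ x → x * (x ∸ 1) + x ≡ x * x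
  falling-square zero = refl
  falling-square (suc x) = trans (+-comm (suc x * x) (suc x)) (cong (suc x +_) (*-comm (suc x) x))

  -- Ordered pairs of distinct tokens among s = k + r = 2t+2, counted by type:
  -- k(k-1) + 2kr + r(r-1) = s(s-1) = (2t+1 + 2t+1)(t+1).
  distinct-pairs : ∀ t k r → k + r ≡ suc t + suc t → k * (k ∸ 1) + 2 * k * r + r * (r ∸ 1) ≡ (suc (t + t) + suc (t + t)) * suc t
  distinct-pairs t k r eq = +-cancelʳ-≡ (k + r) _ _ (begin
      k * (k ∸ 1) + 2 * k * r + r * (r ∸ 1) + (k + r)
        ≡⟨ solve 4 (λ f k g r → f :+ con 2 :* k :* r :+ g :+ (k :+ r) := (f :+ k) :+ con 2 :* k :* r :+ (g :+ r)) refl (k * (k ∸ 1)) k (r * (r ∸ 1)) r ⟩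
      (k * (k ∸ 1) + k) + 2 * k * r + (r * (r ∸ 1) + r)
        ≡⟨ cong₂ (λ x y → x + 2 * k * r + y) (falling-square k) (falling-square r) ⟩
      k * k + 2 * k * r + r * r
        ≡⟨ solve 2 (λ k r → k :* k :+ con 2 :* k :* r :+ r :* r := (k :+ r) :* (k :+ r)) refl k r ⟩
      (k + r) * (k + r)
        ≡⟨ cong (λ z → z * z) eq ⟩
      (suc t + suc t) * (suc t + suc t)
        ≡⟨ solve 1 (λ t → (con 1 :+ t :+ (con 1 :+ t)) :* (con 1 :+ t :+ (con 1 :+ t)) := ((con 1 :+ (t :+ t)) :+ (con 1 :+ (t :+ t))) :* (con 1 :+ t) :+ ((con 1 :+ t) :+ (con 1 :+ t))) refl t ⟩
      (suc (t + t) + suc (t + t)) * suc t + (suc t + suc t)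
        ≡⟨ cong ((suc (t + t) + suc (t + t)) * suc t +_) (sym eq) ⟩
      (suc (t + t) + suc (t + t)) * suc t + (k + r) ∎)
    where
    open ≡-Reasoning

-- A matched pair holds k tracked tokens (weight a at the first
-- endpoint, b at the second) and r untracked ones; φ j is the probability
-- that the first endpoint receives one particular set of j tokens.  Then
--     Ψ φ k r = Σ_{S} φ |S| · a^{#tracked in S} · b^{#tracked not in S},
-- S ranging over all subsets of the k + r tokens, is the expected product
-- of the tracked tokens' weights.  Ψ is defined by deciding the first token.
module SplitSums where

  open import Data.Nat as ℕ using (ℕ; zero; suc; _∸_)
  import Data.Nat.Properties as ℕP
  open import Data.Rational hiding (_<_)
  open import Data.Rational.Properties
  open import Relation.Binary.PropositionalEquality
  open import Function using (_∘_)
  open import Data.Rational.Solver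
  open +-*-Solver
  open RationalFacts

  module SplitSum (a b : ℚ) where

    Ψ : (ℕ → ℚ) → ℕ → ℕ → ℚ
    Ψ φ zero zero = φ 0
    Ψ φ zero (suc r) = Ψ (φ ∘ suc) zero r + Ψ φ zero r
    Ψ φ (suc k) r = a * Ψ (φ ∘ suc) k r + b * Ψ φ k r

    Ψ-cong-upTo : ∀ {φ χ} k r → (∀ j → j ℕ.≤ k ℕ.+ r → φ j ≡ χ j) → Ψ φ k r ≡ Ψ χ k r
    Ψ-cong-upTo zero zero h = h 0 ℕ.z≤n
    Ψ-cong-upTo zero (suc r) h = cong₂ _+_ (Ψ-cong-upTo zero r (λ j j≤ → h (suc j) (ℕ.s≤s j≤)))
                                        (Ψ-cong-upTo zero r (λ j j≤ → h j (ℕP.m≤n⇒m≤1+n j≤)))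
    Ψ-cong-upTo (suc k) r h = cong₂ _+_ (cong (a *_) (Ψ-cong-upTo k r (λ j j≤ → h (suc j) (ℕ.s≤s j≤))))
                                     (cong (b *_) (Ψ-cong-upTo k r (λ j j≤ → h j (ℕP.m≤n⇒m≤1+n j≤))))

    Ψ-cong : ∀ {φ χ} k r → (∀ j → φ j ≡ χ j) → Ψ φ k r ≡ Ψ χ k r
    Ψ-cong k r h = Ψ-cong-upTo k r (λ j _ → h j)

    Ψ-scale : ∀ c φ k r → Ψ (λ j → c * φ j) k r ≡ c * Ψ φ k r
    Ψ-scale c φ zero zero = refl
    Ψ-scale c φ zero (suc r) = trans (cong₂ _+_ (Ψ-scale c (φ ∘ suc) zero r) (Ψ-scale c φ zero r))
       (sym (*-distribˡ-+ c _ _))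
    Ψ-scale c φ (suc k) r = trans (cong₂ _+_ (cong (a *_) (Ψ-scale c (φ ∘ suc) k r)) (cong (b *_) (Ψ-scale c φ k r)))
       (solve 5 (λ c a b x y → a :* (c :* x) :+ b :* (c :* y) := c :* (a :* x :+ b :* y)) refl c a b
         (Ψ (φ ∘ suc) k r) (Ψ φ k r))

    Ψ-add : ∀ φ χ k r → Ψ (λ j → φ j + χ j) k r ≡ Ψ φ k r + Ψ χ k r
    Ψ-add φ χ zero zero = refl
    Ψ-add φ χ zero (suc r) = trans (cong₂ _+_ (Ψ-add (φ ∘ suc) (χ ∘ suc) zero r) (Ψ-add φ χ zero r))
      (solve 4 (λ x y z w → (x :+ y) :+ (z :+ w) := (x :+ z) :+ (y :+ w)) refl (Ψ (φ ∘ suc) zero r) (Ψ (χ ∘ suc) zero r) (Ψ φ zero r) (Ψ χ zero r))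
    Ψ-add φ χ (suc k) r = trans (cong₂ _+_ (cong (a *_) (Ψ-add (φ ∘ suc) (χ ∘ suc) k r)) (cong (b *_) (Ψ-add φ χ k r)))
      (solve 6 (λ a b x y z w → a :* (x :+ y) :+ b :* (z :+ w) := (a :* x :+ b :* z) :+ (a :* y :+ b :* w)) refl a b (Ψ (φ ∘ suc) k r) (Ψ (χ ∘ suc) k r) (Ψ φ k r) (Ψ χ k r))

    -- deciding an untracked token: in S (size shifts) or not
    Ψ-untracked : ∀ φ k r → Ψ φ k (suc r) ≡ Ψ (φ ∘ suc) k r + Ψ φ k r
    Ψ-untracked φ zero r = refl
    Ψ-untracked φ (suc k) r = trans (cong₂ _+_ (cong (a *_) (Ψ-untracked (φ ∘ suc) k r)) (cong (b *_) (Ψ-untracked φ k r)))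
      (solve 6 (λ a b x y z w → a :* (x :+ y) :+ b :* (y :+ w) := (a :* x :+ b :* y) :+ (a :* y :+ b :* w)) refl a b
        (Ψ (φ ∘ suc ∘ suc) k r) (Ψ (φ ∘ suc) k r) (Ψ (φ ∘ suc) k r) (Ψ φ k r))

    Ψ-nonneg : 0ℚ ≤ a → 0ℚ ≤ b → ∀ φ → (∀ j → 0ℚ ≤ φ j) → ∀ k r → 0ℚ ≤ Ψ φ k r
    Ψ-nonneg 0≤a 0≤b φ h zero zero = h 0
    Ψ-nonneg 0≤a 0≤b φ h zero (suc r) = +-nonneg (Ψ-nonneg 0≤a 0≤b (φ ∘ suc) (h ∘ suc) zero r) (Ψ-nonneg 0≤a 0≤b φ h zero r)
    Ψ-nonneg 0≤a 0≤b φ h (suc k) r = +-nonneg (*-nonneg 0≤a (Ψ-nonneg 0≤a 0≤b (φ ∘ suc) (h ∘ suc) k r)) (*-nonneg 0≤b (Ψ-nonneg 0≤a 0≤b φ h k r))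

    -- the recursion equations, valid also for k = 0 resp. r = 0 thanks to the factor ι k resp. ι r
    ι*Ψ-tracked : ∀ φ k r → ι k * Ψ φ k r ≡ ι k * (a * Ψ (φ ∘ suc) (k ∸ 1) r + b * Ψ φ (k ∸ 1) r)
    ι*Ψ-tracked φ zero r = trans (*-zeroˡ (Ψ φ zero r)) (sym (*-zeroˡ (a * Ψ (φ ∘ suc) 0 r + b * Ψ φ 0 r)))
    ι*Ψ-tracked φ (suc k) r = refl

    ι*Ψ-untracked : ∀ φ k r → ι r * Ψ φ k r ≡ ι r * (Ψ (φ ∘ suc) k (r ∸ 1) + Ψ φ k (r ∸ 1))
    ι*Ψ-untracked φ k zero = trans (*-zeroˡ (Ψ φ k zero)) (sym (*-zeroˡ (Ψ (φ ∘ suc) k 0 + Ψ φ k 0)))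
    ι*Ψ-untracked φ k (suc r) = cong (ι (suc r) *_) (Ψ-untracked φ k r)

    private
      ι-suc-* : ∀ (ψ : ℕ → ℚ) j → ι (suc j) * ψ j ≡ ψ j + ι j * ψ j
      ι-suc-* ψ j = trans (cong (_* ψ j) (ι-suc j)) (solve 2 (λ x y → (con 1ℚ :+ x) :* y := y :+ x :* y) refl (ι j) (ψ j))

    Ψ-weight-size₀ : ∀ ψ r → Ψ (λ j → ι j * ψ j) zero r ≡ ι r * Ψ (ψ ∘ suc) zero (r ∸ 1)
    Ψ-weight-size₀ ψ zero = trans (*-zeroˡ (ψ 0)) (sym (*-zeroˡ (ψ 1)))
    Ψ-weight-size₀ ψ (suc r) = begin
        Ψ (λ j → ι (suc j) * ψ (suc j)) zero r + Ψ (λ j → ι j * ψ j) zero r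
          ≡⟨ cong (_+ Ψ (λ j → ι j * ψ j) zero r) (trans (Ψ-cong zero r (ι-suc-* (ψ ∘ suc))) (Ψ-add (ψ ∘ suc) (λ j → ι j * ψ (suc j)) zero r)) ⟩
        (X + Ψ (λ j → ι j * ψ (suc j)) zero r) + Ψ (λ j → ι j * ψ j) zero r
          ≡⟨ cong₂ (λ u v → (X + u) + v) (Ψ-weight-size₀ (ψ ∘ suc) r) (Ψ-weight-size₀ ψ r) ⟩
        (X + ι r * Ψ (ψ ∘ suc ∘ suc) zero (r ∸ 1)) + ι r * Ψ (ψ ∘ suc) zero (r ∸ 1)
          ≡⟨ +-assoc X _ _ ⟩
        X + (ι r * Ψ (ψ ∘ suc ∘ suc) zero (r ∸ 1) + ι r * Ψ (ψ ∘ suc) zero (r ∸ 1))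
          ≡⟨ cong (λ z → X + z) (sym (trans (ι*Ψ-untracked (ψ ∘ suc) zero r) (*-distribˡ-+ (ι r) _ _))) ⟩
        X + ι r * X
          ≡⟨ sym (ι-suc-* (λ _ → X) r) ⟩
        ι (suc r) * X ∎
      where
      open ≡-Reasoning
      X : ℚ
      X = Ψ (ψ ∘ suc) zero r

    -- Weighting by |S| = counting pairs (S, x) with x ∈ S: the chosen token x is
    -- tracked (k choices, weight a) or untracked (r choices).
    Ψ-weight-size : ∀ ψ k r → Ψ (λ j → ι j * ψ j) k r ≡ ι k * a * Ψ (ψ ∘ suc) (k ∸ 1) r + ι r * Ψ (ψ ∘ suc) k (r ∸ 1)
    Ψ-weight-size ψ zero r = trans (Ψ-weight-size₀ ψ r)
      (solve 4 (λ R V a W → R :* V := con 0ℚ :* a :* W :+ R :* V) refl (ι r) (Ψ (ψ ∘ suc) zero (r ∸ 1)) a (Ψ (ψ ∘ suc) zero r))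
    Ψ-weight-size ψ (suc k) r = begin
        a * Ψ (λ j → ι (suc j) * ψ (suc j)) k r + b * Ψ (λ j → ι j * ψ j) k r
          ≡⟨ cong (λ z → a * z + b * Ψ (λ j → ι j * ψ j) k r) (trans (Ψ-cong k r (ι-suc-* (ψ ∘ suc))) (Ψ-add (ψ ∘ suc) (λ j → ι j * ψ (suc j)) k r)) ⟩
        a * (X + Ψ (λ j → ι j * ψ (suc j)) k r) + b * Ψ (λ j → ι j * ψ j) k r
          ≡⟨ cong₂ (λ u v → a * (X + u) + b * v) (Ψ-weight-size (ψ ∘ suc) k r) (Ψ-weight-size ψ k r) ⟩
        a * (X + (ι k * a * P + ι r * U)) + b * (ι k * a * Q + ι r * V)
          ≡⟨ solve 9 (λ a b X P U Q V K R → a :* (X :+ (K :* a :* P :+ R :* U)) :+ b :* (K :* a :* Q :+ R :* V)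
                       := a :* X :+ a :* (K :* (a :* P :+ b :* Q)) :+ R :* (a :* U :+ b :* V)) refl a b X P U Q V (ι k) (ι r) ⟩
        a * X + a * (ι k * (a * P + b * Q)) + ι r * (a * U + b * V)
          ≡⟨ cong (λ z → a * X + a * z + ι r * (a * U + b * V)) (sym (ι*Ψ-tracked (ψ ∘ suc) k r)) ⟩
        a * X + a * (ι k * X) + ι r * (a * U + b * V)
          ≡⟨ solve 5 (λ a X K R U' → a :* X :+ a :* (K :* X) :+ R :* U' := (con 1ℚ :+ K) :* a :* X :+ R :* U') refl a X (ι k) (ι r) (a * U + b * V) ⟩
        (1ℚ + ι k) * a * X + ι r * (a * U + b * V)
          ≡⟨ cong (λ z → z * a * X + ι r * (a * U + b * V)) (sym (ι-suc k)) ⟩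
        ι (suc k) * a * X + ι r * (a * U + b * V) ∎
      where
      open ≡-Reasoning
      X : ℚ
      X = Ψ (ψ ∘ suc) k r
      P : ℚ
      P = Ψ (ψ ∘ suc ∘ suc) (k ∸ 1) r
      Q : ℚ
      Q = Ψ (ψ ∘ suc) (k ∸ 1) r
      U : ℚ
      U = Ψ (ψ ∘ suc ∘ suc) k (r ∸ 1)
      V : ℚ
      V = Ψ (ψ ∘ suc) k (r ∸ 1)

    private
      ι-suc∸-* : ∀ (ψ : ℕ → ℚ) n j → j ℕ.≤ n → ι (suc n ∸ j) * ψ j ≡ ψ j + ι (n ∸ j) * ψ j
      ι-suc∸-* ψ n j j≤n = trans (cong (λ z → ι z * ψ j) (ℕP.+-∸-assoc 1 j≤n)) (ι-suc-* (λ _ → ψ j) (n ∸ j))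

    Ψ-weight-cosize₀ : ∀ ψ r → Ψ (λ j → ι (r ∸ j) * ψ j) zero r ≡ ι r * Ψ ψ zero (r ∸ 1)
    Ψ-weight-cosize₀ ψ zero = trans (*-zeroˡ (ψ 0)) (sym (*-zeroˡ (ψ 0)))
    Ψ-weight-cosize₀ ψ (suc r) = begin
        Ψ (λ j → ι (r ∸ j) * ψ (suc j)) zero r + Ψ (λ j → ι (suc r ∸ j) * ψ j) zero r
          ≡⟨ cong (Ψ (λ j → ι (r ∸ j) * ψ (suc j)) zero r +_) (trans (Ψ-cong-upTo zero r (λ j j≤ → ι-suc∸-* ψ r j j≤)) (Ψ-add ψ (λ j → ι (r ∸ j) * ψ j) zero r)) ⟩
        Ψ (λ j → ι (r ∸ j) * ψ (suc j)) zero r + (X + Ψ (λ j → ι (r ∸ j) * ψ j) zero r)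
          ≡⟨ cong₂ (λ u v → u + (X + v)) (Ψ-weight-cosize₀ (ψ ∘ suc) r) (Ψ-weight-cosize₀ ψ r) ⟩
        ι r * Ψ (ψ ∘ suc) zero (r ∸ 1) + (X + ι r * Ψ ψ zero (r ∸ 1))
          ≡⟨ solve 4 (λ R A X B → R :* A :+ (X :+ R :* B) := X :+ R :* (A :+ B)) refl (ι r) (Ψ (ψ ∘ suc) zero (r ∸ 1)) X (Ψ ψ zero (r ∸ 1)) ⟩
        X + ι r * (Ψ (ψ ∘ suc) zero (r ∸ 1) + Ψ ψ zero (r ∸ 1))
          ≡⟨ cong (λ z → X + z) (sym (ι*Ψ-untracked ψ zero r)) ⟩
        X + ι r * X
          ≡⟨ sym (ι-suc-* (λ _ → X) r) ⟩
        ι (suc r) * X ∎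
      where
      open ≡-Reasoning
      X : ℚ
      X = Ψ ψ zero r

    -- Weighting by |complement of S| = counting pairs (S, x) with x ∉ S.
    Ψ-weight-cosize : ∀ ψ k r → Ψ (λ j → ι (k ℕ.+ r ∸ j) * ψ j) k r ≡ ι k * b * Ψ ψ (k ∸ 1) r + ι r * Ψ ψ k (r ∸ 1)
    Ψ-weight-cosize ψ zero r = trans (Ψ-weight-cosize₀ ψ r)
      (solve 4 (λ R V b W → R :* V := con 0ℚ :* b :* W :+ R :* V) refl (ι r) (Ψ ψ zero (r ∸ 1)) b (Ψ ψ zero r))
    Ψ-weight-cosize ψ (suc k) r = begin
        a * Ψ (λ j → ι (k ℕ.+ r ∸ j) * ψ (suc j)) k r + b * Ψ (λ j → ι (suc (k ℕ.+ r) ∸ j) * ψ j) k r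
          ≡⟨ cong₂ (λ u v → a * u + b * v) (Ψ-weight-cosize (ψ ∘ suc) k r) (trans (Ψ-cong-upTo k r (λ j j≤ → ι-suc∸-* ψ (k ℕ.+ r) j j≤)) (Ψ-add ψ (λ j → ι (k ℕ.+ r ∸ j) * ψ j) k r)) ⟩
        a * (ι k * b * P + ι r * U) + b * (X + Ψ (λ j → ι (k ℕ.+ r ∸ j) * ψ j) k r)
          ≡⟨ cong (λ z → a * (ι k * b * P + ι r * U) + b * (X + z)) (Ψ-weight-cosize ψ k r) ⟩
        a * (ι k * b * P + ι r * U) + b * (X + (ι k * b * Q + ι r * V))
          ≡⟨ solve 9 (λ a b X P U Q V K R → a :* (K :* b :* P :+ R :* U) :+ b :* (X :+ (K :* b :* Q :+ R :* V))
                       := b :* X :+ b :* (K :* (a :* P :+ b :* Q)) :+ R :* (a :* U :+ b :* V)) refl a b X P U Q V (ι k) (ι r) ⟩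
        b * X + b * (ι k * (a * P + b * Q)) + ι r * (a * U + b * V)
          ≡⟨ cong (λ z → b * X + b * z + ι r * (a * U + b * V)) (sym (ι*Ψ-tracked ψ k r)) ⟩
        b * X + b * (ι k * X) + ι r * (a * U + b * V)
          ≡⟨ solve 5 (λ b X K R U' → b :* X :+ b :* (K :* X) :+ R :* U' := (con 1ℚ :+ K) :* b :* X :+ R :* U') refl b X (ι k) (ι r) (a * U + b * V) ⟩
        (1ℚ + ι k) * b * X + ι r * (a * U + b * V)
          ≡⟨ cong (λ z → z * b * X + ι r * (a * U + b * V)) (sym (ι-suc k)) ⟩
        ι (suc k) * b * X + ι r * (a * U + b * V) ∎
      where
      open ≡-Reasoning
      X : ℚ
      X = Ψ ψ k r
      P : ℚ
      P = Ψ (ψ ∘ suc) (k ∸ 1) r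
      Q : ℚ
      Q = Ψ ψ (k ∸ 1) r
      U : ℚ
      U = Ψ (ψ ∘ suc) k (r ∸ 1)
      V : ℚ
      V = Ψ ψ k (r ∸ 1)


-- The balanced split inequality.  balanced t is the law of the uniform
-- choice of t out of 2t tokens.  Multiplying Ψ (balanced (t+1)) by the number
-- (2t+2)(2t+1) of ordered pairs of distinct tokens and removing one chosen
-- and one unchosen token expresses it through Ψ (balanced t) on 2t tokens;
-- the induction hypothesis and a b ≤ ((a+b)/2)² then give Ψ ≤ ((a+b)/2)^k.
-- pairProb (an exact halving, or for an odd number of tokens a fair mixture
-- of the two near-halvings) reduces to this case.
module BalancedSplit where

  open import Data.Nat as ℕ using (ℕ; zero; suc; _∸_; ⌈_/2⌉; ⌊_/2⌋)
  import Data.Nat.Properties as ℕP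
  open import Data.Nat.Combinatorics using (_C_)
  open import Data.Rational hiding (_<_)
  open import Data.Rational using () renaming (_<_ to _<ℚ_)
  open import Data.Rational.Properties
  open import Relation.Binary.PropositionalEquality
  open import Relation.Nullary using (yes; no)
  open import Data.Product using (Σ; _,_)
  open import Data.Sum using (_⊎_; inj₁; inj₂)
  open import Function using (_∘_)
  open import Data.Empty using (⊥-elim)
  open import Data.Rational.Solver
  open +-*-Solver
  open RationalFacts
  open SplitSums
  open Binomials

  balanced : ℕ → ℕ → ℚ
  balanced t j = 𝟙 (j ℕ.≟ t) * inv ((t ℕ.+ t) C t)

  -- 2(2t+1); two-odd t · (t+1) = (2t+2)(2t+1) counts ordered pairs of
  -- distinct tokens among 2t+2
  two-odd : ℕ → ℚ
  two-odd t = ι (suc (t ℕ.+ t)) + ι (suc (t ℕ.+ t))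

  𝟙-suc : ∀ j t → 𝟙 (suc j ℕ.≟ suc t) ≡ 𝟙 (j ℕ.≟ t)
  𝟙-suc j t with j ℕ.≟ t | suc j ℕ.≟ suc t
  ... | yes _ | yes _ = refl
  ... | no _ | no _ = refl
  ... | yes p | no q = ⊥-elim (q (cong suc p))
  ... | no p | yes q = ⊥-elim (p (ℕP.suc-injective q))

  𝟙-scaled : ∀ (j t : ℕ) (x y c c' : ℚ) → (j ≡ t → x * c ≡ y * c') → x * (𝟙 (j ℕ.≟ t) * c) ≡ y * (𝟙 (j ℕ.≟ t) * c')
  𝟙-scaled j t x y c c' h with j ℕ.≟ t
  ... | yes p = trans (cong (x *_) (*-identityˡ c)) (trans (h p) (cong (y *_) (sym (*-identityˡ c'))))
  ... | no _ = trans (cong (x *_) (*-zeroˡ c)) (trans (*-zeroʳ x) (sym (trans (cong (y *_) (*-zeroˡ c')) (*-zeroʳ y))))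

  balanced-size : ∀ t j → ι j * balanced t j ≡ ι t * balanced t j
  balanced-size t j = 𝟙-scaled j t (ι j) (ι t) _ _ (λ p → cong (_* inv ((t ℕ.+ t) C t)) (cong ι p))

  balanced-cosize : ∀ t j → ι (suc (t ℕ.+ t) ∸ j) * balanced t j ≡ ι (suc t) * balanced t j
  balanced-cosize t j = 𝟙-scaled j t (ι (suc (t ℕ.+ t) ∸ j)) (ι (suc t)) (inv ((t ℕ.+ t) C t)) (inv ((t ℕ.+ t) C t))
    (λ { refl → cong (λ z → ι z * inv ((j ℕ.+ j) C j)) (trans (ℕP.+-∸-assoc 1 (ℕP.m≤m+n j j)) (cong suc (ℕP.m+n∸m≡n j j))) })

  -- Conditioning a balanced split of 2t+2 on one token being chosen:
  -- 2(2t+1) / C(2t+2, t+1) = (t+1) / C(2t, t).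
  balanced-shift : ∀ t j → two-odd t * balanced (suc t) (suc j) ≡ ι (suc t) * balanced t j
  balanced-shift t j = trans (cong (λ z → two-odd t * (z * inv ((suc t ℕ.+ suc t) C suc t))) (𝟙-suc j t))
      (𝟙-scaled j t (two-odd t) (ι (suc t)) (inv ((suc t ℕ.+ suc t) C suc t)) (inv ((t ℕ.+ t) C t)) (λ { refl → central j }))
    where
    central : ∀ j → two-odd j * inv ((suc j ℕ.+ suc j) C suc j) ≡ ι (suc j) * inv ((j ℕ.+ j) C j)
    central j = trans (cong (_* inv ((suc j ℕ.+ suc j) C suc j)) (sym (ι-+ (suc (j ℕ.+ j)) (suc (j ℕ.+ j)))))
      (inv-cross (suc (j ℕ.+ j) ℕ.+ suc (j ℕ.+ j)) (suc j) ((suc j ℕ.+ suc j) C suc j) ((j ℕ.+ j) C j) (C-pos (ℕP.m≤m+n (suc j) (suc j))) (C-pos (ℕP.m≤m+n j j))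
        (trans (cong (ℕ._* ((j ℕ.+ j) C j)) (cong (suc (j ℕ.+ j) ℕ.+_) (sym (ℕP.+-identityʳ (suc (j ℕ.+ j))))))
               (sym (central-C-ratio j))))

  module Identities (a b : ℚ) where
    open SplitSum a b

    -- choose an element of the (t-element) chosen set
    size-identity : ∀ t k r → ι t * Ψ (balanced t) k r ≡ ι k * a * Ψ (balanced t ∘ suc) (k ∸ 1) r + ι r * Ψ (balanced t ∘ suc) k (r ∸ 1)
    size-identity t k r = trans (sym (Ψ-scale (ι t) (balanced t) k r)) (trans (Ψ-cong k r (λ j → sym (balanced-size t j))) (Ψ-weight-size (balanced t) k r))

    shift-identity : ∀ t k r → two-odd t * Ψ (balanced (suc t) ∘ suc) k r ≡ ι (suc t) * Ψ (balanced t) k r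
    shift-identity t k r = trans (sym (Ψ-scale (two-odd t) (balanced (suc t) ∘ suc) k r)) (trans (Ψ-cong k r (balanced-shift t)) (Ψ-scale (ι (suc t)) (balanced t) k r))

    -- choose an element outside the chosen set, among 2t+1 tokens
    cosize-identity : ∀ t k r → k ℕ.+ r ≡ suc (t ℕ.+ t) → ι (suc t) * Ψ (balanced t) k r ≡ ι k * b * Ψ (balanced t) (k ∸ 1) r + ι r * Ψ (balanced t) k (r ∸ 1)
    cosize-identity t k r eq = trans (sym (Ψ-scale (ι (suc t)) (balanced t) k r))
       (trans (Ψ-cong k r (λ j → trans (sym (balanced-cosize t j)) (cong (λ n → ι (n ∸ j) * balanced t j) (sym eq)))) (Ψ-weight-cosize (balanced t) k r))

    two-step : ∀ t k r → (two-odd t * ι (suc t)) * Ψ (balanced (suc t)) k r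
               ≡ ι k * a * (ι (suc t) * Ψ (balanced t) (k ∸ 1) r) + ι r * (ι (suc t) * Ψ (balanced t) k (r ∸ 1))
    two-step t k r = begin
        (u * ι T) * Ψ (balanced T) k r
          ≡⟨ *-assoc u (ι T) (Ψ (balanced T) k r) ⟩
        u * (ι T * Ψ (balanced T) k r)
          ≡⟨ cong (u *_) (size-identity T k r) ⟩
        u * (ι k * a * Y₁ + ι r * Y₂)
          ≡⟨ solve 6 (λ u K a Y₁ R Y₂ → u :* (K :* a :* Y₁ :+ R :* Y₂) := K :* a :* (u :* Y₁) :+ R :* (u :* Y₂)) refl u (ι k) a Y₁ (ι r) Y₂ ⟩
        ι k * a * (u * Y₁) + ι r * (u * Y₂)
          ≡⟨ cong₂ (λ x y → ι k * a * x + ι r * y) (shift-identity t (k ∸ 1) r) (shift-identity t k (r ∸ 1)) ⟩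
        ι k * a * (ι T * Ψ (balanced t) (k ∸ 1) r) + ι r * (ι T * Ψ (balanced t) k (r ∸ 1)) ∎
      where
      open ≡-Reasoning
      T : ℕ
      T = suc t
      u : ℚ
      u = two-odd t
      Y₁ : ℚ
      Y₁ = Ψ (balanced T ∘ suc) (k ∸ 1) r
      Y₂ : ℚ
      Y₂ = Ψ (balanced T ∘ suc) k (r ∸ 1)

  module Bound (a b : ℚ) (0≤a : 0ℚ ≤ a) (0≤b : 0ℚ ≤ b) where
    open SplitSum a b
    open Identities a b

    mid : ℚ
    mid = ½ * (a + b)

    0≤mid : 0ℚ ≤ mid
    0≤mid = *-nonneg (nonNegative⁻¹ ½) (+-nonneg 0≤a 0≤b)

    -- a factor ι k makes a hypothesis about k - 1 harmless when k = 0
    ι*c*-mono : ∀ k {x y} c → 0ℚ ≤ c → (∀ k' → k ≡ suc k' → x ≤ y) → ι k * c * x ≤ ι k * c * y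
    ι*c*-mono zero {x} {y} c _ h = ≤-reflexive (trans (*-assoc (ι 0) c x) (trans (*-zeroˡ (c * x)) (sym (trans (*-assoc (ι 0) c y) (*-zeroˡ (c * y))))))
    ι*c*-mono (suc k) c 0≤c h = *-monoˡ-nonneg (*-nonneg (0≤ι (suc k)) 0≤c) (h k refl)

    ι*-mono : ∀ k {x y} → (∀ k' → k ≡ suc k' → x ≤ y) → ι k * x ≤ ι k * y
    ι*-mono zero {x} {y} h = ≤-reflexive (trans (*-zeroˡ x) (sym (*-zeroˡ y)))
    ι*-mono (suc k) h = *-monoˡ-nonneg (0≤ι (suc k)) (h k refl)

    ι*-cong : ∀ k {x y} → (∀ k' → k ≡ suc k' → x ≡ y) → ι k * x ≡ ι k * y
    ι*-cong zero {x} {y} h = trans (*-zeroˡ x) (sym (*-zeroˡ y))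
    ι*-cong (suc k) h = cong (ι (suc k) *_) (h k refl)

    two-odd*-pos : ∀ t → 0ℚ <ℚ two-odd t * ι (suc t)
    two-odd*-pos t = positive⁻¹ (two-odd t * ι (suc t)) {{pos*pos⇒pos (two-odd t) {{positive {two-odd t} (+-mono-<-≤ (0<ι (t ℕ.+ t)) (0≤ι (suc (t ℕ.+ t))))}} (ι (suc t)) {{positive {ι (suc t)} (0<ι t)}}}}

    distinct-pairsℚ : ∀ t k r → k ℕ.+ r ≡ suc t ℕ.+ suc t → ι k * ι (k ∸ 1) + ι 2 * ι k * ι r + ι r * ι (r ∸ 1) ≡ two-odd t * ι (suc t)
    distinct-pairsℚ t k r eq = begin
        ι k * ι (k ∸ 1) + ι 2 * ι k * ι r + ι r * ι (r ∸ 1)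
          ≡⟨ sym (cong₂ _+_ (cong₂ _+_ (ι-* k (k ∸ 1)) (trans (ι-* (2 ℕ.* k) r) (cong (_* ι r) (ι-* 2 k)))) (ι-* r (r ∸ 1))) ⟩
        ι (k ℕ.* (k ∸ 1)) + ι (2 ℕ.* k ℕ.* r) + ι (r ℕ.* (r ∸ 1))
          ≡⟨ sym (trans (ι-+ (k ℕ.* (k ∸ 1) ℕ.+ 2 ℕ.* k ℕ.* r) (r ℕ.* (r ∸ 1))) (cong (_+ ι (r ℕ.* (r ∸ 1))) (ι-+ (k ℕ.* (k ∸ 1)) (2 ℕ.* k ℕ.* r)))) ⟩
        ι (k ℕ.* (k ∸ 1) ℕ.+ 2 ℕ.* k ℕ.* r ℕ.+ r ℕ.* (r ∸ 1))
          ≡⟨ cong ι (distinct-pairs t k r eq) ⟩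
        ι ((suc (t ℕ.+ t) ℕ.+ suc (t ℕ.+ t)) ℕ.* suc t)
          ≡⟨ trans (ι-* (suc (t ℕ.+ t) ℕ.+ suc (t ℕ.+ t)) (suc t)) (cong (_* ι (suc t)) (ι-+ (suc (t ℕ.+ t)) (suc (t ℕ.+ t)))) ⟩
        two-odd t * ι (suc t) ∎
      where open ≡-Reasoning

    -- After removing two tokens, the bounds recombine; the only inequality
    -- used is a b ≤ mid² (for the pairs of two tracked tokens).
    recombine-bound : ∀ k r → ι k * a * (ι (k ∸ 1) * b * pow mid (k ∸ 1 ∸ 1) + ι r * pow mid (k ∸ 1)) + ι r * (ι k * b * pow mid (k ∸ 1) + ι (r ∸ 1) * pow mid k)
                              ≤ (ι k * ι (k ∸ 1) + ι 2 * ι k * ι r + ι r * ι (r ∸ 1)) * pow mid k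
    recombine-bound zero r = ≤-reflexive (solve 4 (λ a b R R1 →
        con 0ℚ :* a :* (con 0ℚ :* b :* con 1ℚ :+ R :* con 1ℚ) :+ R :* (con 0ℚ :* b :* con 1ℚ :+ R1 :* con 1ℚ)
        := (con 0ℚ :* con 0ℚ :+ con (ι 2) :* con 0ℚ :* R :+ R :* R1) :* con 1ℚ) refl a b (ι r) (ι (r ∸ 1)))
    recombine-bound (suc zero) r = ≤-reflexive (solve 4 (λ a b R R1 →
        con 1ℚ :* a :* (con 0ℚ :* b :* con 1ℚ :+ R :* con 1ℚ) :+ R :* (con 1ℚ :* b :* con 1ℚ :+ R1 :* (con ½ :* (a :+ b) :* con 1ℚ))
        := (con 1ℚ :* con 0ℚ :+ con (ι 2) :* con 1ℚ :* R :+ R :* R1) :* (con ½ :* (a :+ b) :* con 1ℚ)) refl a b (ι r) (ι (r ∸ 1)))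
    recombine-bound (suc (suc k)) r = begin
        K * a * (K1 * b * P + R * (m * P)) + R * (K * b * (m * P) + R1 * (m * (m * P)))
          ≡⟨ solve 7 (λ a b P K K1 R R1 →
               K :* a :* (K1 :* b :* P :+ R :* (con ½ :* (a :+ b) :* P)) :+ R :* (K :* b :* (con ½ :* (a :+ b) :* P) :+ R1 :* (con ½ :* (a :+ b) :* (con ½ :* (a :+ b) :* P)))
               := K :* K1 :* (a :* b :* P) :+ (con (ι 2) :* K :* R :+ R :* R1) :* (con ½ :* (a :+ b) :* (con ½ :* (a :+ b) :* P))) refl a b P K K1 R R1 ⟩
        K * K1 * (a * b * P) + (ι 2 * K * R + R * R1) * (m * (m * P))
          ≤⟨ +-monoˡ-≤ ((ι 2 * K * R + R * R1) * (m * (m * P))) (*-monoˡ-nonneg (*-nonneg (0≤ι (suc (suc k))) (0≤ι (suc k))) (*-monoʳ-≤-nonNeg P {{nonNegative (pow-nonneg k 0≤mid)}} (am-gm a b))) ⟩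
        K * K1 * (m * m * P) + (ι 2 * K * R + R * R1) * (m * (m * P))
          ≡⟨ solve 7 (λ m P K K1 R R1 I2 → K :* K1 :* (m :* m :* P) :+ (I2 :* K :* R :+ R :* R1) :* (m :* (m :* P))
               := (K :* K1 :+ I2 :* K :* R :+ R :* R1) :* (m :* (m :* P))) refl m P K K1 R R1 (ι 2) ⟩
        (K * K1 + ι 2 * K * R + R * R1) * (m * (m * P)) ∎
      where
      open ≤-Reasoning
      m : ℚ
      m = mid
      K = ι (suc (suc k))
      K1 : ℚ
      K1 = ι (suc k)
      R : ℚ
      R = ι r
      R1 : ℚ
      R1 = ι (r ∸ 1)
      P : ℚ
      P = pow mid k

    odd-step-bound : ∀ t → (∀ k r → k ℕ.+ r ≡ t ℕ.+ t → Ψ (balanced t) k r ≤ pow mid k)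
                     → ∀ k r → k ℕ.+ r ≡ suc (t ℕ.+ t) → ι (suc t) * Ψ (balanced t) k r ≤ ι k * b * pow mid (k ∸ 1) + ι r * pow mid k
    odd-step-bound t IH k r eq = ≤-trans (≤-reflexive (cosize-identity t k r eq))
      (+-mono-≤ (ι*c*-mono k b 0≤b (λ { k' refl → IH k' r (ℕP.suc-injective eq) }))
                (ι*-mono r (λ { r' refl → IH k r' (ℕP.suc-injective (trans (sym (ℕP.+-suc k r')) eq)) })))

    balanced-bound : ∀ t k r → k ℕ.+ r ≡ t ℕ.+ t → Ψ (balanced t) k r ≤ pow mid k
    balanced-bound zero zero zero refl = ≤-refl
    balanced-bound (suc t) k r eq = *-cancelˡ-pos (two-odd*-pos t) (begin
        (two-odd t * ι (suc t)) * Ψ (balanced (suc t)) k r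
          ≡⟨ two-step t k r ⟩
        ι k * a * (ι (suc t) * Ψ (balanced t) (k ∸ 1) r) + ι r * (ι (suc t) * Ψ (balanced t) k (r ∸ 1))
          ≤⟨ +-mono-≤ (ι*c*-mono k a 0≤a (λ { k' refl → odd-step-bound t (balanced-bound t) k' r (eq-tracked k' eq) }))
                      (ι*-mono r (λ { r' refl → odd-step-bound t (balanced-bound t) k r' (eq-untracked r' eq) })) ⟩
        ι k * a * (ι (k ∸ 1) * b * pow mid (k ∸ 1 ∸ 1) + ι r * pow mid (k ∸ 1)) + ι r * (ι k * b * pow mid (k ∸ 1) + ι (r ∸ 1) * pow mid k)
          ≤⟨ recombine-bound k r ⟩
        (ι k * ι (k ∸ 1) + ι 2 * ι k * ι r + ι r * ι (r ∸ 1)) * pow mid k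
          ≡⟨ cong (_* pow mid k) (distinct-pairsℚ t k r eq) ⟩
        (two-odd t * ι (suc t)) * pow mid k ∎)
      where
      open ≤-Reasoning
      eq-tracked : ∀ k' → suc k' ℕ.+ r ≡ suc t ℕ.+ suc t → k' ℕ.+ r ≡ suc (t ℕ.+ t)
      eq-tracked k' p = trans (ℕP.suc-injective p) (ℕP.+-suc t t)
      eq-untracked : ∀ r' → k ℕ.+ suc r' ≡ suc t ℕ.+ suc t → k ℕ.+ r' ≡ suc (t ℕ.+ t)
      eq-untracked r' p = ℕP.suc-injective (trans (sym (ℕP.+-suc k r')) (trans p (cong suc (ℕP.+-suc t t))))

    -- Equality for k = 0: the split is a probability distribution.
    balanced-untracked : ∀ t r → r ≡ t ℕ.+ t → Ψ (balanced t) 0 r ≡ 1ℚ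
    balanced-untracked zero zero refl = refl
    balanced-untracked (suc t) r eq = *-cancelˡ-pos-≡ (two-odd*-pos t) (begin
        (two-odd t * ι (suc t)) * Ψ (balanced (suc t)) 0 r
          ≡⟨ two-step t 0 r ⟩
        ι 0 * a * X + ι r * (ι (suc t) * Ψ (balanced t) 0 (r ∸ 1))
          ≡⟨ cong (λ y → ι 0 * a * X + ι r * y) (cosize-identity t 0 (r ∸ 1) r∸1≡odd) ⟩
        ι 0 * a * X + ι r * (ι 0 * b * Y + ι (r ∸ 1) * Ψ (balanced t) 0 (r ∸ 1 ∸ 1))
          ≡⟨ cong (λ y → ι 0 * a * X + ι r * (ι 0 * b * Y + ι (r ∸ 1) * y)) (balanced-untracked t (r ∸ 1 ∸ 1) (cong (_∸ 1) r∸1≡odd)) ⟩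
        ι 0 * a * X + ι r * (ι 0 * b * Y + ι (r ∸ 1) * 1ℚ)
          ≡⟨ solve 6 (λ a b X Y R R1 → con 0ℚ :* a :* X :+ R :* (con 0ℚ :* b :* Y :+ R1 :* con 1ℚ)
                      := (con 0ℚ :* con 0ℚ :+ con (ι 2) :* con 0ℚ :* R :+ R :* R1) :* con 1ℚ) refl a b X Y (ι r) (ι (r ∸ 1)) ⟩
        (ι 0 * ι (0 ∸ 1) + ι 2 * ι 0 * ι r + ι r * ι (r ∸ 1)) * 1ℚ
          ≡⟨ cong (_* 1ℚ) (distinct-pairsℚ t 0 r eq) ⟩
        (two-odd t * ι (suc t)) * 1ℚ ∎)
      where
      open ≡-Reasoning
      X : ℚ
      X = ι (suc t) * Ψ (balanced t) 0 r
      Y : ℚ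
      Y = Ψ (balanced t) 0 (r ∸ 1)
      r∸1≡odd : r ∸ 1 ≡ suc (t ℕ.+ t)
      r∸1≡odd = trans (cong (_∸ 1) eq) (ℕP.+-suc t t)

    -- Equality for k = 1: a single tracked token lands at either endpoint w.p. 1/2.
    balanced-one-tracked : ∀ t r → suc r ≡ t ℕ.+ t → Ψ (balanced t) 1 r ≡ mid
    balanced-one-tracked (suc t) r eq = *-cancelˡ-pos-≡ (two-odd*-pos t) (begin
        (two-odd t * ι (suc t)) * Ψ (balanced (suc t)) 1 r
          ≡⟨ two-step t 1 r ⟩
        ι 1 * a * (ι (suc t) * Ψ (balanced t) 0 r) + ι r * (ι (suc t) * Ψ (balanced t) 1 (r ∸ 1))
          ≡⟨ cong₂ (λ x y → ι 1 * a * x + ι r * y) (cosize-identity t 0 r r≡odd) (cosize-identity t 1 (r ∸ 1) (cong suc r∸1≡even)) ⟩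
        ι 1 * a * (ι 0 * b * X + ι r * Y) + ι r * (ι 1 * b * Y + ι (r ∸ 1) * Ψ (balanced t) 1 (r ∸ 1 ∸ 1))
          ≡⟨ cong₂ (λ x y → ι 1 * a * (ι 0 * b * X + ι r * x) + ι r * (ι 1 * b * x + y)) (balanced-untracked t (r ∸ 1) r∸1≡even) inner ⟩
        ι 1 * a * (ι 0 * b * X + ι r * 1ℚ) + ι r * (ι 1 * b * 1ℚ + ι (r ∸ 1) * mid)
          ≡⟨ solve 5 (λ a b X R R1 → con 1ℚ :* a :* (con 0ℚ :* b :* X :+ R :* con 1ℚ) :+ R :* (con 1ℚ :* b :* con 1ℚ :+ R1 :* (con ½ :* (a :+ b)))
                      := (con 1ℚ :* con 0ℚ :+ con (ι 2) :* con 1ℚ :* R :+ R :* R1) :* (con ½ :* (a :+ b))) refl a b X (ι r) (ι (r ∸ 1)) ⟩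
        (ι 1 * ι (1 ∸ 1) + ι 2 * ι 1 * ι r + ι r * ι (r ∸ 1)) * mid
          ≡⟨ cong (_* mid) (distinct-pairsℚ t 1 r eq) ⟩
        (two-odd t * ι (suc t)) * mid ∎)
      where
      open ≡-Reasoning
      X : ℚ
      X = Ψ (balanced t) 0 r
      Y : ℚ
      Y = Ψ (balanced t) 0 (r ∸ 1)
      r≡odd : r ≡ suc (t ℕ.+ t)
      r≡odd = trans (ℕP.suc-injective eq) (ℕP.+-suc t t)
      r∸1≡even : r ∸ 1 ≡ t ℕ.+ t
      r∸1≡even = cong (_∸ 1) r≡odd
      inner : ι (r ∸ 1) * Ψ (balanced t) 1 (r ∸ 1 ∸ 1) ≡ ι (r ∸ 1) * mid
      inner = ι*-cong (r ∸ 1) (λ k' p → balanced-one-tracked t (r ∸ 1 ∸ 1) (trans (cong (λ z → suc (z ∸ 1)) p) (trans (sym p) r∸1≡even)))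

  pairProb-at : ∀ s j c f → ⌈ s /2⌉ ≡ c → ⌊ s /2⌋ ≡ f → pairProb s j ≡ ½ * (𝟙 (j ℕ.≟ c) * inv (s C c)) + ½ * (𝟙 (j ℕ.≟ f) * inv (s C f))
  pairProb-at s j _ _ refl refl = refl

  pairProb-nonneg : ∀ s j → 0ℚ ≤ pairProb s j
  pairProb-nonneg s j = +-nonneg (*-nonneg (nonNegative⁻¹ ½) (*-nonneg (0≤𝟙 (j ℕ.≟ ⌈ s /2⌉)) (0≤inv (s C ⌈ s /2⌉))))
                                 (*-nonneg (nonNegative⁻¹ ½) (*-nonneg (0≤𝟙 (j ℕ.≟ ⌊ s /2⌋)) (0≤inv (s C ⌊ s /2⌋))))

  pairProb-even : ∀ t j → pairProb (t ℕ.+ t) j ≡ balanced t j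
  pairProb-even t j = trans (pairProb-at (t ℕ.+ t) j t t (sym (ℕP.n≡⌈n+n/2⌉ t)) (sym (ℕP.n≡⌊n+n/2⌋ t)))
    (solve 1 (λ x → con ½ :* x :+ con ½ :* x := x) refl (balanced t j))

  half-inv : ∀ X → 0 ℕ.< X → ½ * inv X ≡ inv (2 ℕ.* X)
  half-inv X pos = begin
      ½ * inv X                 ≡⟨ cong (½ *_) (sym (*-identityˡ (inv X))) ⟩
      ½ * (ι 1 * inv X)          ≡⟨ cong (½ *_) (inv-cross 1 2 X (2 ℕ.* X) pos (ℕP.*-mono-< {0} {2} {0} (ℕ.s≤s ℕ.z≤n) pos) (ℕP.*-identityˡ (2 ℕ.* X))) ⟩
      ½ * (ι 2 * inv (2 ℕ.* X))  ≡⟨ solve 1 (λ x → con ½ :* (con (ι 2) :* x) := x) refl (inv (2 ℕ.* X)) ⟩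
      inv (2 ℕ.* X) ∎
    where open ≡-Reasoning

  -- With 2t+1 tokens, the endpoint takes t+1 or t of them with probability 1/2
  -- each; this is the balanced split of 2t+2 tokens, one of which is a phantom
  -- untracked token.
  pairProb-odd : ∀ t j → pairProb (suc (t ℕ.+ t)) j ≡ balanced (suc t) (suc j) + balanced (suc t) j
  pairProb-odd t j = begin
      pairProb (suc (t ℕ.+ t)) j
        ≡⟨ pairProb-at (suc (t ℕ.+ t)) j (suc t) t (cong suc (sym (ℕP.n≡⌊n+n/2⌋ t))) (sym (ℕP.n≡⌈n+n/2⌉ t)) ⟩
      ½ * (𝟙 (j ℕ.≟ suc t) * inv X) + ½ * (𝟙 (j ℕ.≟ t) * inv (suc (t ℕ.+ t) C t))
        ≡⟨ cong (λ z → ½ * (𝟙 (j ℕ.≟ suc t) * inv X) + ½ * (𝟙 (j ℕ.≟ t) * inv z)) (C-odd-sym t) ⟩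
      ½ * (𝟙 (j ℕ.≟ suc t) * inv X) + ½ * (𝟙 (j ℕ.≟ t) * inv X)
        ≡⟨ solve 4 (λ h A B x → h :* (A :* x) :+ h :* (B :* x) := B :* (h :* x) :+ A :* (h :* x)) refl ½ (𝟙 (j ℕ.≟ suc t)) (𝟙 (j ℕ.≟ t)) (inv X) ⟩
      𝟙 (j ℕ.≟ t) * (½ * inv X) + 𝟙 (j ℕ.≟ suc t) * (½ * inv X)
        ≡⟨ cong (λ z → 𝟙 (j ℕ.≟ t) * z + 𝟙 (j ℕ.≟ suc t) * z) (trans (half-inv X (C-pos (ℕ.s≤s (ℕP.m≤m+n t t)))) (cong inv (sym (central-C-double t)))) ⟩
      𝟙 (j ℕ.≟ t) * inv ((suc t ℕ.+ suc t) C suc t) + 𝟙 (j ℕ.≟ suc t) * inv ((suc t ℕ.+ suc t) C suc t)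
        ≡⟨ cong (λ z → z * inv ((suc t ℕ.+ suc t) C suc t) + balanced (suc t) j) (sym (𝟙-suc j t)) ⟩
      balanced (suc t) (suc j) + balanced (suc t) j ∎
    where
    open ≡-Reasoning
    X : ℕ
    X = suc (t ℕ.+ t) C suc t

  parity : ∀ n → Σ ℕ (λ t → (n ≡ t ℕ.+ t) ⊎ (n ≡ suc (t ℕ.+ t)))
  parity zero = 0 , inj₁ refl
  parity (suc n) with parity n
  ... | t , inj₁ p = t , inj₂ (cong suc p)
  ... | t , inj₂ p = suc t , inj₁ (trans (cong suc p) (sym (double-suc t)))

  module PairBound (a b : ℚ) (0≤a : 0ℚ ≤ a) (0≤b : 0ℚ ≤ b) where
    open SplitSum a b
    open Bound a b 0≤a 0≤b

    pairProb-Ψ-nonneg : ∀ s k r → 0ℚ ≤ Ψ (pairProb s) k r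
    pairProb-Ψ-nonneg s = Ψ-nonneg 0≤a 0≤b (pairProb s) (pairProb-nonneg s)

    odd-as-balanced : ∀ t k r → Ψ (pairProb (suc (t ℕ.+ t))) k r ≡ Ψ (balanced (suc t)) k (suc r)
    odd-as-balanced t k r = trans (Ψ-cong k r (pairProb-odd t)) (trans (Ψ-add (balanced (suc t) ∘ suc) (balanced (suc t)) k r) (sym (Ψ-untracked (balanced (suc t)) k r)))

    pairProb-bound : ∀ k r → Ψ (pairProb (k ℕ.+ r)) k r ≤ pow mid k
    pairProb-bound k r with parity (k ℕ.+ r)
    ... | t , inj₁ p = subst (λ n → Ψ (pairProb n) k r ≤ pow mid k) (sym p)
                         (≤-trans (≤-reflexive (Ψ-cong k r (pairProb-even t))) (balanced-bound t k r p))
    ... | t , inj₂ p = subst (λ n → Ψ (pairProb n) k r ≤ pow mid k) (sym p)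
                         (≤-trans (≤-reflexive (odd-as-balanced t k r)) (balanced-bound (suc t) k (suc r) (trans (ℕP.+-suc k r) (trans (cong suc p) (sym (double-suc t))))))

    pairProb-untracked : ∀ r → Ψ (pairProb r) 0 r ≡ 1ℚ
    pairProb-untracked r with parity r
    ... | t , inj₁ p = subst (λ n → Ψ (pairProb n) 0 r ≡ 1ℚ) (sym p) (trans (Ψ-cong 0 r (pairProb-even t)) (balanced-untracked t r p))
    ... | t , inj₂ p = subst (λ n → Ψ (pairProb n) 0 r ≡ 1ℚ) (sym p) (trans (odd-as-balanced t 0 r) (balanced-untracked (suc t) (suc r) (trans (cong suc p) (sym (double-suc t)))))

    pairProb-one-tracked : ∀ r → Ψ (pairProb (suc r)) 1 r ≡ mid
    pairProb-one-tracked r with parity (suc r)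
    ... | t , inj₁ p = subst (λ n → Ψ (pairProb n) 1 r ≡ mid) (sym p) (trans (Ψ-cong 1 r (pairProb-even t)) (balanced-one-tracked t r p))
    ... | t , inj₂ p = subst (λ n → Ψ (pairProb n) 1 r ≡ mid) (sym p) (trans (odd-as-balanced t 1 r) (balanced-one-tracked (suc t) (suc r) (trans (cong suc p) (sym (double-suc t)))))

-- Each matched pair is
-- represented by its smaller endpoint, its "leader"; the transition
-- probability 'step' is a product over tokens (legality of each move) and
-- over leaders (the pair's split probability).  For a node weight g and a set
-- β of tracked tokens we compute E[∏_{i∈β} g(w'_i)] EXACTLY as a product of
-- split sums, one per pair (expectation-formula), and compare it factorwise
-- with ∏_{i∈β} (M g)(w_i) (averaged-product) using the balanced split
-- inequality.
module OneRound where

  open import Data.Nat as ℕ using (ℕ; zero; suc)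
  import Data.Nat.Properties as ℕP
  open import Data.Fin as Fin using (Fin; zero; suc; toℕ)
  import Data.Fin.Properties as FP
  open import Data.Vec using ([]; _∷_; lookup)
  open import Data.List using (List; []; _∷_; foldr; allFin)
  open import Data.Rational hiding (_<_)
  open import Data.Rational.Properties
  open import Data.Bool using (Bool; true; false; if_then_else_; _∧_; _∨_; not)
  open import Relation.Nullary using (Dec; yes; no; does)
  open import Relation.Nullary.Decidable using (dec-true; dec-false)
  open import Relation.Binary.PropositionalEquality
  open import Data.Empty using (⊥; ⊥-elim)
  import Relation.Binary
  open import Data.Bool.Properties using (∧-zeroʳ; ∧-identityʳ; ∨-zeroʳ)
  open import Data.Sum using (_⊎_; inj₁; inj₂)
  open import Function using (_∘_)
  open import Data.Rational.Solver
  open +-*-Solver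
  open RationalFacts
  open FiniteSums

  trackedProduct : ∀ {n m} → (Fin n → ℚ) → (Fin m → Bool) → Config n m → ℚ
  trackedProduct {m = m} g β w' = Πℚ (allFin m) (λ i → if β i then g (lookup w' i) else 1ℚ)

  true≢false : true ≢ false
  true≢false ()

  module Round {n : ℕ} {G : Graph n} (M : Matching G) where
    leader? : Fin n → Bool
    leader? u = does (toℕ u ℕ.<? toℕ (σ M u))

    inPair? : Fin n → Fin n → Bool
    inPair? u x = does (x Fin.≟ u) ∨ does (x Fin.≟ σ M u)

    legalMove : Fin n → Fin n → Bool
    legalMove x y with σ M x Fin.≟ x
    ... | yes _ = does (y Fin.≟ x)
    ... | no  _ = does (y Fin.≟ x) ∨ does (y Fin.≟ σ M x)

    legal-eq : ∀ {m} (w w' : Config n m) i → legal M w w' i ≡ legalMove (lookup w i) (lookup w' i)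
    legal-eq w w' i with σ M (lookup w i) Fin.≟ lookup w i
    ... | yes _ = refl
    ... | no _ = refl

    legalAll : ∀ {m} → Config n m → Config n m → ℚ
    legalAll [] [] = 1ℚ
    legalAll (x ∷ w) (y ∷ w') = indicator (legalMove x y) * legalAll w w'

    arrivals : ∀ {m} → Fin n → Config n m → Config n m → ℕ
    arrivals u [] [] = 0
    arrivals u (x ∷ w) (y ∷ w') = if inPair? u x ∧ does (y Fin.≟ u) then suc (arrivals u w w') else arrivals u w w'

    load : ∀ {m} → Fin n → Config n m → ℕ
    load u [] = 0
    load u (x ∷ w) = if inPair? u x then suc (load u w) else load u w

    stepFormula : ∀ {m} → (Fin n → ℕ → ℚ) → Config n m → Config n m → ℚ
    stepFormula φ w w' = legalAll w w' * Πℚ (allFin n) (λ u → if leader? u then φ u (arrivals u w w') else 1ℚ)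

    count-suc : ∀ {m} (p : Fin (suc m) → Bool) → count p (allFin (suc m)) ≡ (if p zero then suc (count (p ∘ suc) (allFin m)) else count (p ∘ suc) (allFin m))
    count-suc p = foldr-allFin (λ x acc → if p x then suc acc else acc) 0

    load-eq : ∀ {m} u (w : Config n m) → count (λ i → inPair? u (lookup w i)) (allFin m) ≡ load u w
    load-eq u [] = refl
    load-eq u (x ∷ w) = trans (count-suc (λ i → inPair? u (lookup (x ∷ w) i))) (cong (λ z → if inPair? u x then suc z else z) (load-eq u w))

    arrivals-eq : ∀ {m} u (w w' : Config n m) → count (λ i → inPair? u (lookup w i) ∧ does (lookup w' i Fin.≟ u)) (allFin m) ≡ arrivals u w w'
    arrivals-eq u [] [] = refl
    arrivals-eq u (x ∷ w) (y ∷ w') = trans (count-suc (λ i → inPair? u (lookup (x ∷ w) i) ∧ does (lookup (y ∷ w') i Fin.≟ u)))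
       (cong (λ z → if inPair? u x ∧ does (y Fin.≟ u) then suc z else z) (arrivals-eq u w w'))

    pairFactor-eq : ∀ {m} (w w' : Config n m) u → pairFactor M w w' u ≡ (if leader? u then pairProb (load u w) (arrivals u w w') else 1ℚ)
    pairFactor-eq w w' u with toℕ u ℕ.<? toℕ (σ M u) in eq
    ... | yes p = trans (cong₂ pairProb (load-eq u w) (arrivals-eq u w w')) (cong (λ b → if b then pairProb (load u w) (arrivals u w w') else 1ℚ) (sym (dec-true (toℕ u ℕ.<? toℕ (σ M u)) p)))
    ... | no ¬p = cong (λ b → if b then pairProb (load u w) (arrivals u w w') else 1ℚ) (sym (dec-false (toℕ u ℕ.<? toℕ (σ M u)) ¬p))

    indicator-and : ∀ {A : Set} (xs : List A) (β : A → Bool) → indicator (foldr (λ i b → β i ∧ b) true xs) ≡ Πℚ xs (λ i → indicator (β i))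
    indicator-and [] β = refl
    indicator-and (x ∷ xs) β with β x
    ... | true = trans (indicator-and xs β) (sym (*-identityˡ (Πℚ xs (λ i → indicator (β i)))))
    ... | false = sym (*-zeroˡ (Πℚ xs (λ i → indicator (β i))))

    legalAll-Π : ∀ {m} (w w' : Config n m) → legalAll w w' ≡ Πℚ (allFin m) (λ i → indicator (legalMove (lookup w i) (lookup w' i)))
    legalAll-Π [] [] = refl
    legalAll-Π (x ∷ w) (y ∷ w') = trans (cong (indicator (legalMove x y) *_) (legalAll-Π w w')) (sym (Π-suc (λ i → indicator (legalMove (lookup (x ∷ w) i) (lookup (y ∷ w') i)))))

    step-eq : ∀ {m} (w w' : Config n m) → step M w w' ≡ stepFormula (λ u → pairProb (load u w)) w w'
    step-eq {m} w w' = cong₂ _*_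
       (trans (indicator-and (allFin m) (legal M w w')) (trans (Π-cong (allFin m) (λ i → cong indicator (legal-eq w w' i))) (sym (legalAll-Π w w'))))
       (Π-cong (allFin n) (pairFactor-eq w w'))

    does-true : ∀ {P : Set} (d : Dec P) → does d ≡ true → P
    does-true (yes p) _ = p
    does-true (no _) ()

    σ-invol : ∀ u → σ M (σ M u) ≡ u
    σ-invol = invol M

    σ-inj : ∀ {u v} → σ M u ≡ σ M v → u ≡ v
    σ-inj {u} {v} eq = trans (sym (σ-invol u)) (trans (cong (σ M) eq) (σ-invol v))

    unmatched-not-leader : ∀ x → σ M x ≡ x → leader? x ≡ false
    unmatched-not-leader x e = dec-false (toℕ x ℕ.<? toℕ (σ M x)) (λ lt → ℕP.<-irrefl (cong toℕ (sym e)) lt)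

    partner-not-leader : ∀ u → leader? u ≡ true → leader? (σ M u) ≡ false
    partner-not-leader u h = dec-false (toℕ (σ M u) ℕ.<? toℕ (σ M (σ M u)))
      (λ lt → ℕP.<-asym (does-true (toℕ u ℕ.<? toℕ (σ M u)) h) (subst (λ z → toℕ (σ M u) ℕ.< toℕ z) (σ-invol u) lt))

    leader-of-pair : ∀ x → σ M x ≢ x → (leader? x ≡ true) ⊎ (leader? (σ M x) ≡ true)
    leader-of-pair x ne with ℕP.<-cmp (toℕ x) (toℕ (σ M x))
    ... | Relation.Binary.tri< lt _ _ = inj₁ (dec-true (toℕ x ℕ.<? toℕ (σ M x)) lt)
    ... | Relation.Binary.tri≈ _ eq _ = ⊥-elim (ne (sym (FP.toℕ-injective eq)))
    ... | Relation.Binary.tri> _ _ gt = inj₂ (dec-true (toℕ (σ M x) ℕ.<? toℕ (σ M (σ M x))) (subst (λ z → toℕ (σ M x) ℕ.< toℕ z) (sym (σ-invol x)) gt))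

    leader-matched : ∀ u → leader? u ≡ true → σ M u ≢ u
    leader-matched u h e = true≢false (trans (sym h) (unmatched-not-leader u e))

    legal-unmatched : ∀ x y → σ M x ≡ x → indicator (legalMove x y) ≡ 𝟙 (x Fin.≟ y)
    legal-unmatched x y e with σ M x Fin.≟ x
    ... | yes _ = trans (sym (𝟙-does (y Fin.≟ x))) (𝟙≡ (y Fin.≟ x) (x Fin.≟ y) sym sym)
    ... | no ne = ⊥-elim (ne e)

    legal-matched : ∀ x y → σ M x ≢ x → indicator (legalMove x y) ≡ 𝟙 (x Fin.≟ y) + 𝟙 (σ M x Fin.≟ y)
    legal-matched x y ne with σ M x Fin.≟ x
    ... | yes e = ⊥-elim (ne e)
    ... | no _ with y Fin.≟ x | y Fin.≟ σ M x | x Fin.≟ y | σ M x Fin.≟ y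
    ... | yes p | yes q | _ | _ = ⊥-elim (ne (trans (sym q) p))
    ... | yes p | no _ | yes _ | no _ = refl
    ... | no _ | yes q | no _ | yes _ = refl
    ... | no _ | no _ | no _ | no _ = refl
    ... | yes p | _ | no ¬p | _ = ⊥-elim (¬p (sym p))
    ... | no ¬p | _ | yes p | _ = ⊥-elim (¬p (sym p))
    ... | _ | yes q | _ | no ¬q = ⊥-elim (¬q (sym q))
    ... | _ | no ¬q | _ | yes q = ⊥-elim (¬q (sym q))

    Σ-legal-unmatched : ∀ x (H : Fin n → ℚ) → σ M x ≡ x → Σℚ (allFin n) (λ y → indicator (legalMove x y) * H y) ≡ H x
    Σ-legal-unmatched x H e = trans (Σ-cong (allFin n) (λ y → cong (_* H y) (legal-unmatched x y e))) (Σ-delta x H)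

    Σ-legal-matched : ∀ x (H : Fin n → ℚ) → σ M x ≢ x → Σℚ (allFin n) (λ y → indicator (legalMove x y) * H y) ≡ H x + H (σ M x)
    Σ-legal-matched x H ne = trans (Σ-cong (allFin n) (λ y → trans (cong (_* H y) (legal-matched x y ne)) (*-distribʳ-+ (H y) (𝟙 (x Fin.≟ y)) (𝟙 (σ M x Fin.≟ y)))))
      (trans (Σ-+ (allFin n) (λ y → 𝟙 (x Fin.≟ y) * H y) (λ y → 𝟙 (σ M x Fin.≟ y) * H y)) (cong₂ _+_ (Σ-delta x H) (Σ-delta (σ M x) H)))

    InPair : Fin n → Fin n → Set
    InPair r x = (x ≡ r) ⊎ (x ≡ σ M r)

    other-leader-∉ : ∀ r x u → leader? r ≡ true → InPair r x → leader? u ≡ true → u ≢ r → inPair? u x ≡ false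
    other-leader-∉ r x u hr ip hu ne with x Fin.≟ u | x Fin.≟ σ M u
    ... | no _ | no _ = refl
    ... | yes p | _ = ⊥-elim (lem ip)
      where
      lem : InPair r x → ⊥
      lem (inj₁ q) = ne (trans (sym p) q)
      lem (inj₂ q) = true≢false (trans (sym hu) (subst (λ z → leader? z ≡ false) (sym (trans (sym p) q)) (partner-not-leader r hr)))
    ... | no _ | yes p = ⊥-elim (lem ip)
      where
      lem : InPair r x → ⊥
      lem (inj₁ q) = true≢false (trans (sym hu) (subst (λ z → leader? z ≡ false) (trans (cong (σ M) (trans (sym q) p)) (σ-invol u)) (partner-not-leader r hr)))
      lem (inj₂ q) = ne (σ-inj (trans (sym p) q))

    unmatched-∉ : ∀ x u → σ M x ≡ x → leader? u ≡ true → inPair? u x ≡ false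
    unmatched-∉ x u e hu with x Fin.≟ u | x Fin.≟ σ M u
    ... | no _ | no _ = refl
    ... | yes p | _ = ⊥-elim (leader-matched u hu (subst (λ z → σ M z ≡ z) p e))
    ... | no _ | yes p = ⊥-elim (leader-matched u hu (trans (sym p) (sym (trans (sym (σ-invol u)) (trans (cong (σ M) (sym p)) e)))))

    own-pair-∈ : ∀ r x → InPair r x → inPair? r x ≡ true
    own-pair-∈ r x (inj₁ q) = cong (_∨ does (x Fin.≟ σ M r)) (dec-true (x Fin.≟ r) q)
    own-pair-∈ r x (inj₂ q) = trans (cong (does (x Fin.≟ r) ∨_) (dec-true (x Fin.≟ σ M r) q)) (∨-zeroʳ (does (x Fin.≟ r)))

    unmatched? : Fin n → Bool
    unmatched? x = does (σ M x Fin.≟ x)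

    pairFactors : ∀ {m} → (Fin n → ℕ → ℚ) → Config n m → Config n m → ℚ
    pairFactors φ w w' = Πℚ (allFin n) (λ u → if leader? u then φ u (arrivals u w w') else 1ℚ)

    -- the split law of r's pair after one token has already been given to r
    shiftAt : (Fin n → ℕ → ℚ) → Fin n → (Fin n → ℕ → ℚ)
    shiftAt φ r u = if does (u Fin.≟ r) then (φ r ∘ suc) else φ u

    pairFactors-unmatched : ∀ {m} φ x (w w' : Config n m) → σ M x ≡ x → pairFactors φ (x ∷ w) (x ∷ w') ≡ pairFactors φ w w'
    pairFactors-unmatched φ x w w' e = Π-cong (allFin n) pt
      where
      pt : ∀ u → (if leader? u then φ u (arrivals u (x ∷ w) (x ∷ w')) else 1ℚ) ≡ (if leader? u then φ u (arrivals u w w') else 1ℚ)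
      pt u with leader? u in hu
      ... | false = refl
      ... | true = cong (φ u) (if-false (cong (_∧ does (x Fin.≟ u)) (unmatched-∉ x u e hu)))

    pairFactors-leader : ∀ {m} φ r x (w w' : Config n m) → leader? r ≡ true → InPair r x → pairFactors φ (x ∷ w) (r ∷ w') ≡ pairFactors (shiftAt φ r) w w'
    pairFactors-leader φ r x w w' hr ip = Π-cong (allFin n) pt
      where
      pt : ∀ u → (if leader? u then φ u (arrivals u (x ∷ w) (r ∷ w')) else 1ℚ) ≡ (if leader? u then shiftAt φ r u (arrivals u w w') else 1ℚ)
      pt u with leader? u in hu
      ... | false = refl
      ... | true with u Fin.≟ r
      ...   | yes refl = cong (φ u) (if-true (trans (cong (_∧ does (u Fin.≟ u)) (own-pair-∈ u x ip)) (dec-true (u Fin.≟ u) refl)))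
      ...   | no ne = cong (φ u) (if-false (cong (_∧ does (r Fin.≟ u)) (other-leader-∉ r x u hr ip hu ne)))

    pairFactors-partner : ∀ {m} φ r x (w w' : Config n m) → leader? r ≡ true → pairFactors φ (x ∷ w) (σ M r ∷ w') ≡ pairFactors φ w w'
    pairFactors-partner φ r x w w' hr = Π-cong (allFin n) pt
      where
      pt : ∀ u → (if leader? u then φ u (arrivals u (x ∷ w) (σ M r ∷ w')) else 1ℚ) ≡ (if leader? u then φ u (arrivals u w w') else 1ℚ)
      pt u with leader? u in hu
      ... | false = refl
      ... | true = cong (φ u) (if-false (trans (cong (inPair? u x ∧_) (dec-false (σ M r Fin.≟ u) ne)) (∧-zeroʳ (inPair? u x))))
        where
        ne : σ M r ≢ u
        ne p = true≢false (trans (sym hu) (subst (λ z → leader? z ≡ false) p (partner-not-leader r hr)))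

    module Expectation (g : Fin n → ℚ) where
      open SplitSums using (module SplitSum)

      Ψg : Fin n → (ℕ → ℚ) → ℕ → ℕ → ℚ
      Ψg u φ k r = SplitSum.Ψ (g u) (g (σ M u)) φ k r

      unmatchedWeight : ∀ {m} → Config n m → (Fin m → Bool) → ℚ
      unmatchedWeight [] β = 1ℚ
      unmatchedWeight (x ∷ w) β = (if β zero ∧ unmatched? x then g x else 1ℚ) * unmatchedWeight w (β ∘ suc)

      tracked : ∀ {m} → Fin n → Config n m → (Fin m → Bool) → ℕ
      tracked u [] β = 0
      tracked u (x ∷ w) β = if β zero ∧ inPair? u x then suc (tracked u w (β ∘ suc)) else tracked u w (β ∘ suc)

      untracked : ∀ {m} → Fin n → Config n m → (Fin m → Bool) → ℕ
      untracked u [] β = 0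
      untracked u (x ∷ w) β = if not (β zero) ∧ inPair? u x then suc (untracked u w (β ∘ suc)) else untracked u w (β ∘ suc)

      pairSplitSums : ∀ {m} → (Fin n → ℕ → ℚ) → Config n m → (Fin m → Bool) → ℚ
      pairSplitSums φ w β = Πℚ (allFin n) (λ u → if leader? u then Ψg u (φ u) (tracked u w β) (untracked u w β) else 1ℚ)

      otherPairs : ∀ {m} → (Fin n → ℕ → ℚ) → Config n m → (Fin m → Bool) → Fin n → ℚ
      otherPairs φ w β r = Πℚ (allFin n) (λ u → if does (u Fin.≟ r) then 1ℚ else (if leader? u then Ψg u (φ u) (tracked u w β) (untracked u w β) else 1ℚ))

      pairSplitSums-extract : ∀ {m} (φ : Fin n → ℕ → ℚ) (w : Config n m) β r → leader? r ≡ true → pairSplitSums φ w β ≡ Ψg r (φ r) (tracked r w β) (untracked r w β) * otherPairs φ w β r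
      pairSplitSums-extract φ w β r hr = trans (Π-extract r (λ u → if leader? u then Ψg u (φ u) (tracked u w β) (untracked u w β) else 1ℚ))
        (cong (_* otherPairs φ w β r) (if-true hr))

      pairSplitSums-shiftAt : ∀ {m} (φ : Fin n → ℕ → ℚ) (w : Config n m) β r → leader? r ≡ true → pairSplitSums (shiftAt φ r) w β ≡ Ψg r (φ r ∘ suc) (tracked r w β) (untracked r w β) * otherPairs φ w β r
      pairSplitSums-shiftAt φ w β r hr = trans (Π-extract r (λ u → if leader? u then Ψg u (shiftAt φ r u) (tracked u w β) (untracked u w β) else 1ℚ))
        (cong₂ _*_ (trans (if-true hr) (cong (λ z → Ψg r z (tracked r w β) (untracked r w β)) (if-true (dec-true (r Fin.≟ r) refl))))
                   (Π-cong (allFin n) pt))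
        where
        pt : ∀ u → (if does (u Fin.≟ r) then 1ℚ else (if leader? u then Ψg u (shiftAt φ r u) (tracked u w β) (untracked u w β) else 1ℚ))
                 ≡ (if does (u Fin.≟ r) then 1ℚ else (if leader? u then Ψg u (φ u) (tracked u w β) (untracked u w β) else 1ℚ))
        pt u with u Fin.≟ r
        ... | yes _ = refl
        ... | no _ = refl

      trackedProduct-suc : ∀ {m} (β : Fin (suc m) → Bool) y (w' : Config n m) → trackedProduct g β (y ∷ w') ≡ (if β zero then g y else 1ℚ) * trackedProduct g (β ∘ suc) w'
      trackedProduct-suc β y w' = Π-suc (λ i → if β i then g (lookup (y ∷ w') i) else 1ℚ)

      otherPairs-cons : ∀ {m} (φ : Fin n → ℕ → ℚ) x (w : Config n m) β r → (∀ u → leader? u ≡ true → u ≢ r → inPair? u x ≡ false) → otherPairs φ (x ∷ w) β r ≡ otherPairs φ w (β ∘ suc) r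
      otherPairs-cons φ x w β r h = Π-cong (allFin n) pt
        where
        pt : ∀ u → (if does (u Fin.≟ r) then 1ℚ else (if leader? u then Ψg u (φ u) (tracked u (x ∷ w) β) (untracked u (x ∷ w) β) else 1ℚ))
                 ≡ (if does (u Fin.≟ r) then 1ℚ else (if leader? u then Ψg u (φ u) (tracked u w (β ∘ suc)) (untracked u w (β ∘ suc)) else 1ℚ))
        pt u with u Fin.≟ r
        ... | yes _ = refl
        ... | no ne with leader? u in hu
        ...   | false = refl
        ...   | true = cong₂ (Ψg u (φ u))
                   (if-false (trans (cong (β zero ∧_) (h u hu ne)) (∧-zeroʳ (β zero))))
                   (if-false (trans (cong (not (β zero) ∧_) (h u hu ne)) (∧-zeroʳ (not (β zero)))))

      pairSplitSums-unmatched : ∀ {m} (φ : Fin n → ℕ → ℚ) x (w : Config n m) β → σ M x ≡ x → pairSplitSums φ (x ∷ w) β ≡ pairSplitSums φ w (β ∘ suc)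
      pairSplitSums-unmatched φ x w β e = Π-cong (allFin n) pt
        where
        pt : ∀ u → (if leader? u then Ψg u (φ u) (tracked u (x ∷ w) β) (untracked u (x ∷ w) β) else 1ℚ)
                 ≡ (if leader? u then Ψg u (φ u) (tracked u w (β ∘ suc)) (untracked u w (β ∘ suc)) else 1ℚ)
        pt u with leader? u in hu
        ... | false = refl
        ... | true = cong₂ (Ψg u (φ u))
                   (if-false (trans (cong (β zero ∧_) (unmatched-∉ x u e hu)) (∧-zeroʳ (β zero))))
                   (if-false (trans (cong (not (β zero) ∧_) (unmatched-∉ x u e hu)) (∧-zeroʳ (not (β zero)))))

      Ψ-first-token : ∀ {m} (φ : Fin n → ℕ → ℚ) r x (w : Config n m) (β' : Fin m → Bool) b → inPair? r x ≡ true →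
        (if b then g r else 1ℚ) * Ψg r (φ r ∘ suc) (tracked r w β') (untracked r w β') + (if b then g (σ M r) else 1ℚ) * Ψg r (φ r) (tracked r w β') (untracked r w β')
        ≡ Ψg r (φ r) (if b ∧ inPair? r x then suc (tracked r w β') else tracked r w β') (if not b ∧ inPair? r x then suc (untracked r w β') else untracked r w β')
      Ψ-first-token φ r x w β' true h rewrite h = refl
      Ψ-first-token φ r x w β' false h rewrite h = trans (cong₂ _+_ (*-identityˡ (Ψg r (φ r ∘ suc) (tracked r w β') (untracked r w β'))) (*-identityˡ (Ψg r (φ r) (tracked r w β') (untracked r w β')))) (sym (SplitSum.Ψ-untracked (g r) (g (σ M r)) (φ r) (tracked r w β') (untracked r w β')))

      expectation : ∀ {m} → (Fin n → ℕ → ℚ) → Config n m → (Fin m → Bool) → ℚ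
      expectation {m} φ w β = Σℚ (allConfigs n m) (λ w' → stepFormula φ w w' * trackedProduct g β w')

      firstAt : ∀ {m} → (Fin n → ℕ → ℚ) → Fin n → Config n m → (Fin (suc m) → Bool) → Config n m → Fin n → ℚ
      firstAt φ x w β w' y = legalAll w w' * pairFactors φ (x ∷ w) (y ∷ w') * ((if β zero then g y else 1ℚ) * trackedProduct g (β ∘ suc) w')

      expectation-cons : ∀ {m} φ x (w : Config n m) β → expectation φ (x ∷ w) β ≡ Σℚ (allConfigs n m) (λ w' → Σℚ (allFin n) (λ y → indicator (legalMove x y) * firstAt φ x w β w' y))
      expectation-cons {m} φ x w β = trans (Σ-allConfigs-suc n m (λ w' → stepFormula φ (x ∷ w) w' * trackedProduct g β w')) (Σ-cong (allConfigs n m) (λ w' → Σ-cong (allFin n) (rearrange w')))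
        where
        rearrange : ∀ w' y → stepFormula φ (x ∷ w) (y ∷ w') * trackedProduct g β (y ∷ w') ≡ indicator (legalMove x y) * firstAt φ x w β w' y
        rearrange w' y = trans (cong (stepFormula φ (x ∷ w) (y ∷ w') *_) (trackedProduct-suc β y w'))
          (solve 5 (λ a l p f t → (a :* l) :* p :* (f :* t) := a :* (l :* p :* (f :* t))) refl (indicator (legalMove x y)) (legalAll w w') (pairFactors φ (x ∷ w) (y ∷ w')) (if β zero then g y else 1ℚ) (trackedProduct g (β ∘ suc) w'))

      Formula : ∀ {m} → (Fin n → ℕ → ℚ) → Config n m → (Fin m → Bool) → Set
      Formula φ w β = expectation φ w β ≡ unmatchedWeight w β * pairSplitSums φ w β

      formula-unmatched : ∀ {m} φ x (w : Config n m) β → σ M x ≡ x → Formula φ w (β ∘ suc) → Formula φ (x ∷ w) β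
      formula-unmatched {m} φ x w β e IH = begin
          expectation φ (x ∷ w) β
            ≡⟨ expectation-cons φ x w β ⟩
          Σℚ cfg (λ w' → Σℚ (allFin n) (λ y → indicator (legalMove x y) * firstAt φ x w β w' y))
            ≡⟨ Σ-cong cfg (λ w' → Σ-legal-unmatched x (firstAt φ x w β w') e) ⟩
          Σℚ cfg (λ w' → firstAt φ x w β w' x)
            ≡⟨ Σ-cong cfg (λ w' → trans (cong (λ z → legalAll w w' * z * (F0 * trackedProduct g β' w')) (pairFactors-unmatched φ x w w' e))
                 (solve 4 (λ l p f t → l :* p :* (f :* t) := f :* (l :* p :* t)) refl (legalAll w w') (pairFactors φ w w') F0 (trackedProduct g β' w'))) ⟩
          Σℚ cfg (λ w' → F0 * (stepFormula φ w w' * trackedProduct g β' w'))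
            ≡⟨ Σ-scaleˡ cfg F0 (λ w' → stepFormula φ w w' * trackedProduct g β' w') ⟩
          F0 * expectation φ w β'
            ≡⟨ cong (F0 *_) IH ⟩
          F0 * (unmatchedWeight w β' * pairSplitSums φ w β')
            ≡⟨ sym (*-assoc F0 (unmatchedWeight w β') (pairSplitSums φ w β')) ⟩
          F0 * unmatchedWeight w β' * pairSplitSums φ w β'
            ≡⟨ cong₂ (λ a b → a * unmatchedWeight w β' * b) (sym own-weight) (sym (pairSplitSums-unmatched φ x w β e)) ⟩
          unmatchedWeight (x ∷ w) β * pairSplitSums φ (x ∷ w) β ∎
        where
        open ≡-Reasoning
        cfg : List (Config n m)
        cfg = allConfigs n m
        β' : Fin m → Bool
        β' = β ∘ suc
        F0 : ℚ
        F0 = if β zero then g x else 1ℚ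
        own-weight : (if β zero ∧ unmatched? x then g x else 1ℚ) ≡ F0
        own-weight = cong (λ b → if b then g x else 1ℚ) (trans (cong (β zero ∧_) (dec-true (σ M x Fin.≟ x) e)) (∧-identityʳ (β zero)))

      expectation-pair : ∀ {m} φ r x (w : Config n m) β → leader? r ≡ true → InPair r x →
        Σℚ (allConfigs n m) (λ w' → firstAt φ x w β w' r + firstAt φ x w β w' (σ M r))
        ≡ (if β zero then g r else 1ℚ) * expectation (shiftAt φ r) w (β ∘ suc) + (if β zero then g (σ M r) else 1ℚ) * expectation φ w (β ∘ suc)
      expectation-pair {m} φ r x w β hr ip = begin
          Σℚ cfg (λ w' → firstAt φ x w β w' r + firstAt φ x w β w' (σ M r))
            ≡⟨ Σ-cong cfg (λ w' → cong₂ _+_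
                 (trans (cong (λ z → legalAll w w' * z * (Fr * trackedProduct g β' w')) (pairFactors-leader φ r x w w' hr ip))
                    (solve 4 (λ l p f t → l :* p :* (f :* t) := f :* (l :* p :* t)) refl (legalAll w w') (pairFactors (shiftAt φ r) w w') Fr (trackedProduct g β' w')))
                 (trans (cong (λ z → legalAll w w' * z * (Fσ * trackedProduct g β' w')) (pairFactors-partner φ r x w w' hr))
                    (solve 4 (λ l p f t → l :* p :* (f :* t) := f :* (l :* p :* t)) refl (legalAll w w') (pairFactors φ w w') Fσ (trackedProduct g β' w')))) ⟩
          Σℚ cfg (λ w' → Fr * (stepFormula (shiftAt φ r) w w' * trackedProduct g β' w') + Fσ * (stepFormula φ w w' * trackedProduct g β' w'))
            ≡⟨ Σ-+ cfg (λ w' → Fr * (stepFormula (shiftAt φ r) w w' * trackedProduct g β' w')) (λ w' → Fσ * (stepFormula φ w w' * trackedProduct g β' w')) ⟩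
          Σℚ cfg (λ w' → Fr * (stepFormula (shiftAt φ r) w w' * trackedProduct g β' w')) + Σℚ cfg (λ w' → Fσ * (stepFormula φ w w' * trackedProduct g β' w'))
            ≡⟨ cong₂ _+_ (Σ-scaleˡ cfg Fr (λ w' → stepFormula (shiftAt φ r) w w' * trackedProduct g β' w')) (Σ-scaleˡ cfg Fσ (λ w' → stepFormula φ w w' * trackedProduct g β' w')) ⟩
          Fr * expectation (shiftAt φ r) w β' + Fσ * expectation φ w β' ∎
        where
        open ≡-Reasoning
        cfg : List (Config n m)
        cfg = allConfigs n m
        β' : Fin m → Bool
        β' = β ∘ suc
        Fr : ℚ
        Fr = if β zero then g r else 1ℚ
        Fσ : ℚ
        Fσ = if β zero then g (σ M r) else 1ℚ

      formula-matched : ∀ {m} φ r x (w : Config n m) β → σ M x ≢ x → leader? r ≡ true → InPair r x →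
        Formula (shiftAt φ r) w (β ∘ suc) → Formula φ w (β ∘ suc) →
        (if β zero then g r else 1ℚ) * expectation (shiftAt φ r) w (β ∘ suc) + (if β zero then g (σ M r) else 1ℚ) * expectation φ w (β ∘ suc)
        ≡ unmatchedWeight (x ∷ w) β * pairSplitSums φ (x ∷ w) β
      formula-matched {m} φ r x w β ne hr ip IH-shift IH = begin
          Fr * expectation (shiftAt φ r) w β' + Fσ * expectation φ w β'
            ≡⟨ cong₂ (λ a b → Fr * a + Fσ * b) IH-shift IH ⟩
          Fr * (U * pairSplitSums (shiftAt φ r) w β') + Fσ * (U * pairSplitSums φ w β')
            ≡⟨ cong₂ (λ a b → Fr * (U * a) + Fσ * (U * b)) (pairSplitSums-shiftAt φ w β' r hr) (pairSplitSums-extract φ w β' r hr) ⟩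
          Fr * (U * (Ψg r (φ r ∘ suc) k k̄ * Rst)) + Fσ * (U * (Ψg r (φ r) k k̄ * Rst))
            ≡⟨ solve 6 (λ a b U X Y R → a :* (U :* (X :* R)) :+ b :* (U :* (Y :* R)) := (con 1ℚ :* U) :* ((a :* X :+ b :* Y) :* R)) refl
                 Fr Fσ U (Ψg r (φ r ∘ suc) k k̄) (Ψg r (φ r) k k̄) Rst ⟩
          (1ℚ * U) * ((Fr * Ψg r (φ r ∘ suc) k k̄ + Fσ * Ψg r (φ r) k k̄) * Rst)
            ≡⟨ cong (λ z → (1ℚ * U) * (z * Rst)) (Ψ-first-token φ r x w β' (β zero) (own-pair-∈ r x ip)) ⟩
          (1ℚ * U) * (Ψg r (φ r) (tracked r (x ∷ w) β) (untracked r (x ∷ w) β) * Rst)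
            ≡⟨ cong₂ (λ a b → (a * U) * (Ψg r (φ r) (tracked r (x ∷ w) β) (untracked r (x ∷ w) β) * b)) (sym own-weight) (sym (otherPairs-cons φ x w β r (λ u hu ne' → other-leader-∉ r x u hr ip hu ne'))) ⟩
          unmatchedWeight (x ∷ w) β * (Ψg r (φ r) (tracked r (x ∷ w) β) (untracked r (x ∷ w) β) * otherPairs φ (x ∷ w) β r)
            ≡⟨ cong (unmatchedWeight (x ∷ w) β *_) (sym (pairSplitSums-extract φ (x ∷ w) β r hr)) ⟩
          unmatchedWeight (x ∷ w) β * pairSplitSums φ (x ∷ w) β ∎
        where
        open ≡-Reasoning
        β' : Fin m → Bool
        β' = β ∘ suc
        U : ℚ
        U = unmatchedWeight w β'
        Fr : ℚ
        Fr = if β zero then g r else 1ℚ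
        Fσ : ℚ
        Fσ = if β zero then g (σ M r) else 1ℚ
        k : ℕ
        k = tracked r w β'
        k̄ : ℕ
        k̄ = untracked r w β'
        Rst : ℚ
        Rst = otherPairs φ w β' r
        own-weight : (if β zero ∧ unmatched? x then g x else 1ℚ) ≡ 1ℚ
        own-weight = if-false (trans (cong (β zero ∧_) (dec-false (σ M x Fin.≟ x) ne)) (∧-zeroʳ (β zero)))

      expectation-formula : ∀ {m} (φ : Fin n → ℕ → ℚ) (w : Config n m) (β : Fin m → Bool) → Formula φ w β
      expectation-formula φ [] β = solve 1 (λ X → (con 1ℚ :* X) :* con 1ℚ :+ con 0ℚ := con 1ℚ :* X) refl (pairFactors φ [] [])
      expectation-formula φ (x ∷ w) β = by-cases (σ M x Fin.≟ x)
        where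
        Pair-sum : ℚ
        Pair-sum = Σℚ (allConfigs n _) (λ w' → firstAt φ x w β w' x + firstAt φ x w β w' (σ M x))
        via : ∀ r → leader? r ≡ true → InPair r x → (∀ w' → firstAt φ x w β w' x + firstAt φ x w β w' (σ M x) ≡ firstAt φ x w β w' r + firstAt φ x w β w' (σ M r))
              → σ M x ≢ x → Pair-sum ≡ unmatchedWeight (x ∷ w) β * pairSplitSums φ (x ∷ w) β
        via r hr ip same ne = trans (Σ-cong (allConfigs n _) same) (trans (expectation-pair φ r x w β hr ip)
                                (formula-matched φ r x w β ne hr ip (expectation-formula (shiftAt φ r) w (β ∘ suc)) (expectation-formula φ w (β ∘ suc))))
        matched : σ M x ≢ x → (leader? x ≡ true) ⊎ (leader? (σ M x) ≡ true) → Pair-sum ≡ unmatchedWeight (x ∷ w) β * pairSplitSums φ (x ∷ w) β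
        matched ne (inj₁ hr) = via x hr (inj₁ refl) (λ w' → refl) ne
        matched ne (inj₂ hr) = via (σ M x) hr (inj₂ (sym (σ-invol x)))
          (λ w' → trans (+-comm (firstAt φ x w β w' x) _) (cong (λ z → firstAt φ x w β w' (σ M x) + firstAt φ x w β w' z) (sym (σ-invol x)))) ne
        by-cases : Dec (σ M x ≡ x) → Formula φ (x ∷ w) β
        by-cases (yes e) = formula-unmatched φ x w β e (expectation-formula φ w (β ∘ suc))
        by-cases (no ne) = trans (expectation-cons φ x w β) (trans (Σ-cong (allConfigs n _) (λ w' → Σ-legal-matched x (firstAt φ x w β w') ne)) (matched ne (leader-of-pair x ne)))

      averaged : Fin n → ℚ
      averaged u = Σℚ (allFin n) (λ v → matMatrix M u v * g v)

      pairMean : Fin n → ℚ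
      pairMean u = ½ * (g u + g (σ M u))

      matMatrix-unmatched : ∀ u v → σ M u ≡ u → matMatrix M u v ≡ 𝟙 (u Fin.≟ v)
      matMatrix-unmatched u v e with σ M u Fin.≟ u
      ... | yes _ = refl
      ... | no ne = ⊥-elim (ne e)

      matMatrix-matched : ∀ u v → σ M u ≢ u → matMatrix M u v ≡ ½ * 𝟙 (u Fin.≟ v) + ½ * 𝟙 (σ M u Fin.≟ v)
      matMatrix-matched u v ne with σ M u Fin.≟ u
      ... | yes e = ⊥-elim (ne e)
      ... | no _ with v Fin.≟ u | v Fin.≟ σ M u | u Fin.≟ v | σ M u Fin.≟ v
      ... | yes p | yes q | _ | _ = ⊥-elim (ne (trans (sym q) p))
      ... | yes p | no _ | yes _ | no _ = refl
      ... | no _ | yes q | no _ | yes _ = refl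
      ... | no _ | no _ | no _ | no _ = refl
      ... | yes p | _ | no ¬p | _ = ⊥-elim (¬p (sym p))
      ... | no ¬p | _ | yes p | _ = ⊥-elim (¬p (sym p))
      ... | _ | yes q | _ | no ¬q = ⊥-elim (¬q (sym q))
      ... | _ | no ¬q | _ | yes q = ⊥-elim (¬q (sym q))

      averaged-unmatched : ∀ u → σ M u ≡ u → averaged u ≡ g u
      averaged-unmatched u e = trans (Σ-cong (allFin n) (λ v → cong (_* g v) (matMatrix-unmatched u v e))) (Σ-delta u g)

      averaged-matched : ∀ u → σ M u ≢ u → averaged u ≡ pairMean u
      averaged-matched u ne = begin
          Σℚ (allFin n) (λ v → matMatrix M u v * g v)
            ≡⟨ Σ-cong (allFin n) (λ v → trans (cong (_* g v) (matMatrix-matched u v ne))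
                 (solve 4 (λ a b c x → (con ½ :* a :+ con ½ :* b) :* x := con ½ :* (a :* x) :+ con ½ :* (b :* x)) refl (𝟙 (u Fin.≟ v)) (𝟙 (σ M u Fin.≟ v)) ½ (g v))) ⟩
          Σℚ (allFin n) (λ v → ½ * (𝟙 (u Fin.≟ v) * g v) + ½ * (𝟙 (σ M u Fin.≟ v) * g v))
            ≡⟨ Σ-+ (allFin n) (λ v → ½ * (𝟙 (u Fin.≟ v) * g v)) (λ v → ½ * (𝟙 (σ M u Fin.≟ v) * g v)) ⟩
          Σℚ (allFin n) (λ v → ½ * (𝟙 (u Fin.≟ v) * g v)) + Σℚ (allFin n) (λ v → ½ * (𝟙 (σ M u Fin.≟ v) * g v))
            ≡⟨ cong₂ _+_ (trans (Σ-scaleˡ (allFin n) ½ (λ v → 𝟙 (u Fin.≟ v) * g v)) (cong (½ *_) (Σ-delta u g)))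
                         (trans (Σ-scaleˡ (allFin n) ½ (λ v → 𝟙 (σ M u Fin.≟ v) * g v)) (cong (½ *_) (Σ-delta (σ M u) g))) ⟩
          ½ * g u + ½ * g (σ M u)
            ≡⟨ sym (*-distribˡ-+ ½ (g u) (g (σ M u))) ⟩
          pairMean u ∎
        where open ≡-Reasoning

      pairMeanPowers : ∀ {m} → Config n m → (Fin m → Bool) → ℚ
      pairMeanPowers w β = Πℚ (allFin n) (λ u → if leader? u then pow (pairMean u) (tracked u w β) else 1ℚ)

      otherPairMeans : ∀ {m} → Config n m → (Fin m → Bool) → Fin n → ℚ
      otherPairMeans w β r = Πℚ (allFin n) (λ u → if does (u Fin.≟ r) then 1ℚ else (if leader? u then pow (pairMean u) (tracked u w β) else 1ℚ))

      otherPairMeans-cons : ∀ {m} x (w : Config n m) β r → (∀ u → leader? u ≡ true → u ≢ r → inPair? u x ≡ false) → otherPairMeans (x ∷ w) β r ≡ otherPairMeans w (β ∘ suc) r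
      otherPairMeans-cons x w β r h = Π-cong (allFin n) pt
        where
        pt : ∀ u → (if does (u Fin.≟ r) then 1ℚ else (if leader? u then pow (pairMean u) (tracked u (x ∷ w) β) else 1ℚ))
                 ≡ (if does (u Fin.≟ r) then 1ℚ else (if leader? u then pow (pairMean u) (tracked u w (β ∘ suc)) else 1ℚ))
        pt u with u Fin.≟ r
        ... | yes _ = refl
        ... | no ne with leader? u in hu
        ...   | false = refl
        ...   | true = cong (pow (pairMean u)) (if-false (trans (cong (β zero ∧_) (h u hu ne)) (∧-zeroʳ (β zero))))

      pairMeanPowers-extract : ∀ {m} (w : Config n m) β r → leader? r ≡ true → pairMeanPowers w β ≡ pow (pairMean r) (tracked r w β) * otherPairMeans w β r
      pairMeanPowers-extract w β r hr = trans (Π-extract r (λ u → if leader? u then pow (pairMean u) (tracked u w β) else 1ℚ)) (cong (_* otherPairMeans w β r) (if-true hr))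

      pairMeanPowers-unmatched : ∀ {m} x (w : Config n m) β → σ M x ≡ x → pairMeanPowers (x ∷ w) β ≡ pairMeanPowers w (β ∘ suc)
      pairMeanPowers-unmatched x w β e = Π-cong (allFin n) pt
        where
        pt : ∀ u → (if leader? u then pow (pairMean u) (tracked u (x ∷ w) β) else 1ℚ) ≡ (if leader? u then pow (pairMean u) (tracked u w (β ∘ suc)) else 1ℚ)
        pt u with leader? u in hu
        ... | false = refl
        ... | true = cong (pow (pairMean u)) (if-false (trans (cong (β zero ∧_) (unmatched-∉ x u e hu)) (∧-zeroʳ (β zero))))

      Product : ∀ {m} → Config n m → (Fin m → Bool) → Set
      Product {m} w β = Πℚ (allFin m) (λ i → if β i then averaged (lookup w i) else 1ℚ) ≡ unmatchedWeight w β * pairMeanPowers w β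

      product-unmatched : ∀ {m} x (w : Config n m) β → σ M x ≡ x →
        (if β zero then averaged x else 1ℚ) * (unmatchedWeight w (β ∘ suc) * pairMeanPowers w (β ∘ suc)) ≡ unmatchedWeight (x ∷ w) β * pairMeanPowers (x ∷ w) β
      product-unmatched x w β e = trans (sym (*-assoc (if β zero then averaged x else 1ℚ) (unmatchedWeight w (β ∘ suc)) (pairMeanPowers w (β ∘ suc))))
          (cong₂ (λ a b → a * unmatchedWeight w (β ∘ suc) * b) own-weight (sym (pairMeanPowers-unmatched x w β e)))
        where
        own-weight : (if β zero then averaged x else 1ℚ) ≡ (if β zero ∧ unmatched? x then g x else 1ℚ)
        own-weight = trans (cong (λ z → if β zero then z else 1ℚ) (averaged-unmatched x e))
             (cong (λ b → if b then g x else 1ℚ) (sym (trans (cong (β zero ∧_) (dec-true (σ M x Fin.≟ x) e)) (∧-identityʳ (β zero)))))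

      product-matched : ∀ {m} x (w : Config n m) β → σ M x ≢ x → ∀ r → leader? r ≡ true → InPair r x → averaged x ≡ pairMean r →
        (if β zero then averaged x else 1ℚ) * (unmatchedWeight w (β ∘ suc) * pairMeanPowers w (β ∘ suc)) ≡ unmatchedWeight (x ∷ w) β * pairMeanPowers (x ∷ w) β
      product-matched {m} x w β ne r hr ip mean = begin
          (if β zero then averaged x else 1ℚ) * (U * pairMeanPowers w β')
            ≡⟨ cong₂ (λ a z → a * (U * z)) (cong (λ z → if β zero then z else 1ℚ) mean) (pairMeanPowers-extract w β' r hr) ⟩
          (if β zero then pairMean r else 1ℚ) * (U * (pow (pairMean r) (tracked r w β') * Rst))
            ≡⟨ raise (β zero) ⟩
          (1ℚ * U) * (pow (pairMean r) (if β zero then suc (tracked r w β') else tracked r w β') * Rst)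
            ≡⟨ cong₂ (λ a b → (a * U) * (pow (pairMean r) b * Rst)) (sym own-weight) (sym (cong (λ b → if b then suc (tracked r w β') else tracked r w β') (trans (cong (β zero ∧_) (own-pair-∈ r x ip)) (∧-identityʳ (β zero))))) ⟩
          unmatchedWeight (x ∷ w) β * (pow (pairMean r) (tracked r (x ∷ w) β) * Rst)
            ≡⟨ cong (λ z → unmatchedWeight (x ∷ w) β * (pow (pairMean r) (tracked r (x ∷ w) β) * z)) (sym (otherPairMeans-cons x w β r (λ u hu ne' → other-leader-∉ r x u hr ip hu ne'))) ⟩
          unmatchedWeight (x ∷ w) β * (pow (pairMean r) (tracked r (x ∷ w) β) * otherPairMeans (x ∷ w) β r)
            ≡⟨ cong (unmatchedWeight (x ∷ w) β *_) (sym (pairMeanPowers-extract (x ∷ w) β r hr)) ⟩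
          unmatchedWeight (x ∷ w) β * pairMeanPowers (x ∷ w) β ∎
        where
        open ≡-Reasoning
        β' : Fin m → Bool
        β' = β ∘ suc
        U : ℚ
        U = unmatchedWeight w β'
        Rst : ℚ
        Rst = otherPairMeans w β' r
        own-weight : (if β zero ∧ unmatched? x then g x else 1ℚ) ≡ 1ℚ
        own-weight = if-false (trans (cong (β zero ∧_) (dec-false (σ M x Fin.≟ x) ne)) (∧-zeroʳ (β zero)))
        raise : ∀ b → (if b then pairMean r else 1ℚ) * (U * (pow (pairMean r) (tracked r w β') * Rst))
                  ≡ (1ℚ * U) * (pow (pairMean r) (if b then suc (tracked r w β') else tracked r w β') * Rst)
        raise true = solve 4 (λ m U P R → m :* (U :* (P :* R)) := (con 1ℚ :* U) :* ((m :* P) :* R)) refl (pairMean r) U (pow (pairMean r) (tracked r w β')) Rst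
        raise false = solve 3 (λ U P R → con 1ℚ :* (U :* (P :* R)) := (con 1ℚ :* U) :* (P :* R)) refl U (pow (pairMean r) (tracked r w β')) Rst

      averaged-product : ∀ {m} (w : Config n m) β → Product w β
      averaged-product [] β = sym (trans (*-identityˡ (pairMeanPowers [] β)) (trans (Π-cong (allFin n) (λ u → if-idem (leader? u))) (Π-ones (allFin n))))
        where
        if-idem : ∀ b → (if b then 1ℚ else 1ℚ) ≡ 1ℚ
        if-idem true = refl
        if-idem false = refl
      averaged-product (x ∷ w) β = trans (Π-suc (λ i → if β i then averaged (lookup (x ∷ w) i) else 1ℚ))
          (trans (cong ((if β zero then averaged x else 1ℚ) *_) (averaged-product w (β ∘ suc))) (by-cases (σ M x Fin.≟ x)))
        where
        by-cases : Dec (σ M x ≡ x) → (if β zero then averaged x else 1ℚ) * (unmatchedWeight w (β ∘ suc) * pairMeanPowers w (β ∘ suc)) ≡ unmatchedWeight (x ∷ w) β * pairMeanPowers (x ∷ w) β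
        by-cases (yes e) = product-unmatched x w β e
        by-cases (no ne) with leader-of-pair x ne
        ... | inj₁ hr = product-matched x w β ne x hr (inj₁ refl) (averaged-matched x ne)
        ... | inj₂ hr = product-matched x w β ne (σ M x) hr (inj₂ (sym (σ-invol x))) (trans (averaged-matched x ne) (cong (½ *_) (trans (+-comm (g x) (g (σ M x))) (cong (λ z → g (σ M x) + g z) (sym (σ-invol x))))))

      load-split : ∀ {m} u (w : Config n m) β → load u w ≡ tracked u w β ℕ.+ untracked u w β
      load-split u [] β = refl
      load-split u (x ∷ w) β with β zero | inPair? u x
      ... | true | true = cong suc (load-split u w (β ∘ suc))
      ... | false | true = trans (cong suc (load-split u w (β ∘ suc))) (sym (ℕP.+-suc (tracked u w (β ∘ suc)) (untracked u w (β ∘ suc))))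
      ... | true | false = load-split u w (β ∘ suc)
      ... | false | false = load-split u w (β ∘ suc)

      tracked-cong : ∀ {m} u (w : Config n m) β β' → (∀ j → β j ≡ β' j) → tracked u w β ≡ tracked u w β'
      tracked-cong u [] β β' h = refl
      tracked-cong u (x ∷ w) β β' h rewrite h zero = cong (λ z → if β' zero ∧ inPair? u x then suc z else z) (tracked-cong u w (β ∘ suc) (β' ∘ suc) (h ∘ suc))

      tracked-none : ∀ {m} u (w : Config n m) β → (∀ j → β j ≡ false) → tracked u w β ≡ 0
      tracked-none u [] β h = refl
      tracked-none u (x ∷ w) β h rewrite h zero = tracked-none u w (β ∘ suc) (h ∘ suc)

      tracked-single : ∀ {m} u (w : Config n m) (i : Fin m) → tracked u w (λ j → does (j Fin.≟ i)) ℕ.≤ 1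
      tracked-single u (x ∷ w) zero with inPair? u x
      ... | true = ℕ.s≤s (ℕP.≤-reflexive (tracked-none u w (λ j → does (suc j Fin.≟ zero)) (λ j → refl)))
      ... | false = ℕP.≤-trans (ℕP.≤-reflexive (tracked-none u w (λ j → does (suc j Fin.≟ zero)) (λ j → refl))) ℕ.z≤n
      tracked-single u (x ∷ w) (suc i) = ℕP.≤-trans (ℕP.≤-reflexive (tracked-cong u w (λ j → does (suc j Fin.≟ suc i)) (λ j → does (j Fin.≟ i))
                                 (λ j → does≡ (suc j Fin.≟ suc i) (j Fin.≟ i) FP.suc-injective (cong suc)))) (tracked-single u w i)

      step-expectation : ∀ {m} (w : Config n m) β → Σℚ (allConfigs n m) (λ w' → step M w w' * trackedProduct g β w') ≡ unmatchedWeight w β * pairSplitSums (λ u → pairProb (load u w)) w β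
      step-expectation {m} w β = trans (Σ-cong (allConfigs n m) (λ w' → cong (_* trackedProduct g β w') (step-eq w w'))) (expectation-formula (λ u → pairProb (load u w)) w β)

      module Bounds (0≤g : ∀ v → 0ℚ ≤ g v) where
        open BalancedSplit using (module PairBound)

        unmatchedWeight-nonneg : ∀ {m} (w : Config n m) β → 0ℚ ≤ unmatchedWeight w β
        unmatchedWeight-nonneg [] β = nonNegative⁻¹ 1ℚ
        unmatchedWeight-nonneg (x ∷ w) β = *-nonneg (own (β zero ∧ unmatched? x)) (unmatchedWeight-nonneg w (β ∘ suc))
          where
          own : ∀ b → 0ℚ ≤ (if b then g x else 1ℚ)
          own true = 0≤g x
          own false = nonNegative⁻¹ 1ℚ

        averaged-nonneg : ∀ u → 0ℚ ≤ averaged u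
        averaged-nonneg u = by-cases (σ M u Fin.≟ u)
          where
          by-cases : Dec (σ M u ≡ u) → 0ℚ ≤ averaged u
          by-cases (yes e) = ≤-trans (0≤g u) (≤-reflexive (sym (averaged-unmatched u e)))
          by-cases (no ne) = ≤-trans (*-nonneg (nonNegative⁻¹ ½) (+-nonneg (0≤g u) (0≤g (σ M u)))) (≤-reflexive (sym (averaged-matched u ne)))

        one-round-bound : ∀ {m} (w : Config n m) β → Σℚ (allConfigs n m) (λ w' → step M w w' * trackedProduct g β w') ≤ Πℚ (allFin m) (λ i → if β i then averaged (lookup w i) else 1ℚ)
        one-round-bound {m} w β = begin
            Σℚ (allConfigs n m) (λ w' → step M w w' * trackedProduct g β w')
              ≡⟨ step-expectation w β ⟩
            unmatchedWeight w β * pairSplitSums (λ u → pairProb (load u w)) w β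
              ≤⟨ *-monoˡ-nonneg (unmatchedWeight-nonneg w β) (Π-mono (allFin n) split-nonneg split-bound) ⟩
            unmatchedWeight w β * pairMeanPowers w β
              ≡⟨ sym (averaged-product w β) ⟩
            Πℚ (allFin m) (λ i → if β i then averaged (lookup w i) else 1ℚ) ∎
          where
          open ≤-Reasoning
          split-nonneg : ∀ u → 0ℚ ≤ (if leader? u then Ψg u (pairProb (load u w)) (tracked u w β) (untracked u w β) else 1ℚ)
          split-nonneg u with leader? u
          ... | true = PairBound.pairProb-Ψ-nonneg (g u) (g (σ M u)) (0≤g u) (0≤g (σ M u)) (load u w) (tracked u w β) (untracked u w β)
          ... | false = nonNegative⁻¹ 1ℚ
          split-bound : ∀ u → (if leader? u then Ψg u (pairProb (load u w)) (tracked u w β) (untracked u w β) else 1ℚ) ≤ (if leader? u then pow (pairMean u) (tracked u w β) else 1ℚ)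
          split-bound u with leader? u
          ... | true = subst (λ s → Ψg u (pairProb s) (tracked u w β) (untracked u w β) ≤ pow (pairMean u) (tracked u w β)) (sym (load-split u w β))
                         (PairBound.pairProb-bound (g u) (g (σ M u)) (0≤g u) (0≤g (σ M u)) (tracked u w β) (untracked u w β))
          ... | false = ≤-refl

        one-round-exact : ∀ {m} (w : Config n m) β → (∀ u → tracked u w β ℕ.≤ 1) → Σℚ (allConfigs n m) (λ w' → step M w w' * trackedProduct g β w') ≡ Πℚ (allFin m) (λ i → if β i then averaged (lookup w i) else 1ℚ)
        one-round-exact {m} w β ≤1 = trans (step-expectation w β) (trans (cong (unmatchedWeight w β *_) (Π-cong (allFin n) split-exact)) (sym (averaged-product w β)))
          where
          at-most-one : ∀ u k r → k ℕ.≤ 1 → Ψg u (pairProb (k ℕ.+ r)) k r ≡ pow (pairMean u) k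
          at-most-one u zero r _ = PairBound.pairProb-untracked (g u) (g (σ M u)) (0≤g u) (0≤g (σ M u)) r
          at-most-one u (suc zero) r _ = trans (PairBound.pairProb-one-tracked (g u) (g (σ M u)) (0≤g u) (0≤g (σ M u)) r) (sym (*-identityʳ (pairMean u)))
          at-most-one u (suc (suc k)) r (ℕ.s≤s ())
          split-exact : ∀ u → (if leader? u then Ψg u (pairProb (load u w)) (tracked u w β) (untracked u w β) else 1ℚ) ≡ (if leader? u then pow (pairMean u) (tracked u w β) else 1ℚ)
          split-exact u with leader? u
          ... | true = trans (cong (λ s → Ψg u (pairProb s) (tracked u w β) (untracked u w β)) (load-split u w β)) (at-most-one u (tracked u w β) (untracked u w β) (≤1 u))
          ... | false = refl

        one-round-single-token : ∀ {m} (w : Config n m) (i : Fin m) → Σℚ (allConfigs n m) (λ w' → step M w w' * g (lookup w' i)) ≡ averaged (lookup w i)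
        one-round-single-token {m} w i = trans (Σ-cong (allConfigs n m) (λ w' → cong (step M w w' *_) (sym (Π-delta i (λ j → g (lookup w' j))))))
           (trans (one-round-exact w (λ j → does (j Fin.≟ i)) (λ u → tracked-single u w i)) (Π-delta i (λ j → averaged (lookup w j))))

module Iteration where

  open import Data.Nat as ℕ using (ℕ; zero; suc)
  open import Data.Fin as Fin using (Fin; zero; suc)
  open import Data.Fin.Subset using (Subset)
  open import Data.Fin.Subset.Properties using (_∈?_)
  open import Data.Vec using (lookup)
  open import Data.Vec.Properties using (≡-dec)
  open import Data.List using (List; allFin)
  open import Data.Rational hiding (_<_)
  open import Data.Rational.Properties hiding (_<?_)
  open import Data.Bool using (Bool; true; false; if_then_else_)
  open import Relation.Nullary using (yes; no; does)
  open import Relation.Binary.PropositionalEquality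
  open RationalFacts
  open FiniteSums
  open BalancedSplit using (pairProb-nonneg)
  open OneRound

  applyM : ∀ {n} → Matrix n → (Fin n → ℚ) → Fin n → ℚ
  applyM {n} A g u = Σℚ (allFin n) (λ v → A u v * g v)

  applyM-⊗ : ∀ {n} (A B : Matrix n) g u → applyM (A ⊗ B) g u ≡ applyM A (applyM B g) u
  applyM-⊗ {n} A B g u = begin
      Σℚ (allFin n) (λ v → Σℚ (allFin n) (λ x → A u x * B x v) * g v)
        ≡⟨ Σ-cong (allFin n) (λ v → sym (Σ-scaleʳ (allFin n) (g v) (λ x → A u x * B x v))) ⟩
      Σℚ (allFin n) (λ v → Σℚ (allFin n) (λ x → A u x * B x v * g v))
        ≡⟨ Σ-swap (allFin n) (allFin n) (λ v x → A u x * B x v * g v) ⟩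
      Σℚ (allFin n) (λ x → Σℚ (allFin n) (λ v → A u x * B x v * g v))
        ≡⟨ Σ-cong (allFin n) (λ x → trans (Σ-cong (allFin n) (λ v → *-assoc (A u x) (B x v) (g v))) (Σ-scaleˡ (allFin n) (A u x) (λ v → B x v * g v))) ⟩
      Σℚ (allFin n) (λ x → A u x * Σℚ (allFin n) (λ v → B x v * g v)) ∎
    where open ≡-Reasoning

  rowSum-applyM : ∀ {n} (A : Matrix n) u (D : Subset n) → rowSum A u D ≡ applyM A (λ v → 𝟙 (v ∈? D)) u
  rowSum-applyM {n} A u D = Σ-cong (allFin n) entry
    where
    entry : ∀ v → (if does (v ∈? D) then A u v else 0ℚ) ≡ A u v * 𝟙 (v ∈? D)
    entry v with v ∈? D
    ... | yes _ = sym (*-identityʳ (A u v))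
    ... | no _ = sym (*-zeroʳ (A u v))

  ΠB-cong : ∀ {m} (B : Subset m) {f f' : Fin m → ℚ} → (∀ i → f i ≡ f' i) → ΠB B f ≡ ΠB B f'
  ΠB-cong {m} B eq = Π-cong (allFin m) (λ i → cong (λ z → if does (i ∈? B) then z else 1ℚ) (eq i))

  step-nonneg : ∀ {n m} {G : Graph n} (N : Matching G) (w w' : Config n m) → 0ℚ ≤ step N w w'
  step-nonneg {n} N w w' = *-nonneg (indicator-nonneg (allLegal N w w')) (Π-nonneg (allFin n) (λ u → ≤-trans (factor-nonneg u) (≤-reflexive (sym (Round.pairFactor-eq N w w' u)))))
    where
    indicator-nonneg : ∀ b → 0ℚ ≤ (if b then 1ℚ else 0ℚ)
    indicator-nonneg true = nonNegative⁻¹ 1ℚ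
    indicator-nonneg false = ≤-refl
    factor-nonneg : ∀ u → 0ℚ ≤ (if Round.leader? N u then pairProb (Round.load N u w) (Round.arrivals N u w w') else 1ℚ)
    factor-nonneg u with Round.leader? N u
    ... | true = pairProb-nonneg (Round.load N u w) (Round.arrivals N u w w')
    ... | false = nonNegative⁻¹ 1ℚ

  module Rounds {n : ℕ} {G : Graph n} (M : ℕ → Matching G) (t₁ : ℕ) where

    run-nonneg : ∀ {m} k (w w' : Config n m) → 0ℚ ≤ run M t₁ k w w'
    run-nonneg zero w w' = 0≤𝟙 (≡-dec Fin._≟_ w w')
    run-nonneg {m} (suc k) w w' = Σ-nonneg (allConfigs n m) (λ w'' → *-nonneg (run-nonneg k w w'') (step-nonneg (M (suc (t₁ ℕ.+ k))) w'' w'))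

    run-suc : ∀ {m} k (w : Config n m) (F : Config n m → ℚ) →
      Σℚ (allConfigs n m) (λ w' → run M t₁ (suc k) w w' * F w')
      ≡ Σℚ (allConfigs n m) (λ w'' → run M t₁ k w w'' * Σℚ (allConfigs n m) (λ w' → step (M (suc (t₁ ℕ.+ k))) w'' w' * F w'))
    run-suc {m} k w F = begin
        Σℚ cfg (λ w' → Σℚ cfg (λ w'' → run M t₁ k w w'' * step N w'' w') * F w')
          ≡⟨ Σ-cong cfg (λ w' → trans (sym (Σ-scaleʳ cfg (F w') (λ w'' → run M t₁ k w w'' * step N w'' w'))) (Σ-cong cfg (λ w'' → *-assoc (run M t₁ k w w'') (step N w'' w') (F w')))) ⟩
        Σℚ cfg (λ w' → Σℚ cfg (λ w'' → run M t₁ k w w'' * (step N w'' w' * F w')))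
          ≡⟨ Σ-swap cfg cfg (λ w' w'' → run M t₁ k w w'' * (step N w'' w' * F w')) ⟩
        Σℚ cfg (λ w'' → Σℚ cfg (λ w' → run M t₁ k w w'' * (step N w'' w' * F w')))
          ≡⟨ Σ-cong cfg (λ w'' → Σ-scaleˡ cfg (run M t₁ k w w'') (λ w' → step N w'' w' * F w')) ⟩
        Σℚ cfg (λ w'' → run M t₁ k w w'' * Σℚ cfg (λ w' → step N w'' w' * F w')) ∎
      where
      open ≡-Reasoning
      cfg : List (Config n m)
      cfg = allConfigs n m
      N : Matching G
      N = M (suc (t₁ ℕ.+ k))

    run-product-bound : ∀ {m} (β : Fin m → Bool) k (g : Fin n → ℚ) → (∀ v → 0ℚ ≤ g v) → (w : Config n m) →
      Σℚ (allConfigs n m) (λ w' → run M t₁ k w w' * trackedProduct g β w') ≤ Πℚ (allFin m) (λ i → if β i then applyM (Mprod M t₁ k) g (lookup w i) else 1ℚ)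
    run-product-bound {m} β zero g 0≤g w = ≤-reflexive (trans (Σ-allConfigs-delta n m w (trackedProduct g β))
      (Π-cong (allFin m) (λ i → cong (λ z → if β i then z else 1ℚ) (sym (Σ-delta (lookup w i) g)))))
    run-product-bound {m} β (suc k) g 0≤g w = begin
        Σℚ cfg (λ w' → run M t₁ (suc k) w w' * trackedProduct g β w')
          ≡⟨ run-suc k w (trackedProduct g β) ⟩
        Σℚ cfg (λ w'' → run M t₁ k w w'' * Σℚ cfg (λ w' → step N w'' w' * trackedProduct g β w'))
          ≤⟨ Σ-mono cfg (λ w'' → *-monoˡ-nonneg (run-nonneg k w w'') (Round.Expectation.Bounds.one-round-bound N g 0≤g w'' β)) ⟩
        Σℚ cfg (λ w'' → run M t₁ k w w'' * trackedProduct g' β w'')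
          ≤⟨ run-product-bound β k g' (Round.Expectation.Bounds.averaged-nonneg N g 0≤g) w ⟩
        Πℚ (allFin m) (λ i → if β i then applyM (Mprod M t₁ k) g' (lookup w i) else 1ℚ)
          ≡⟨ Π-cong (allFin m) (λ i → cong (λ z → if β i then z else 1ℚ) (sym (applyM-⊗ (Mprod M t₁ k) (matMatrix N) g (lookup w i)))) ⟩
        Πℚ (allFin m) (λ i → if β i then applyM (Mprod M t₁ (suc k)) g (lookup w i) else 1ℚ) ∎
      where
      open ≤-Reasoning
      cfg : List (Config n m)
      cfg = allConfigs n m
      N : Matching G
      N = M (suc (t₁ ℕ.+ k))
      g' : Fin n → ℚ
      g' = applyM (matMatrix N) g

    run-single-token : ∀ {m} k (g : Fin n → ℚ) → (∀ v → 0ℚ ≤ g v) → (w : Config n m) (i : Fin m) →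
      Σℚ (allConfigs n m) (λ w' → run M t₁ k w w' * g (lookup w' i)) ≡ applyM (Mprod M t₁ k) g (lookup w i)
    run-single-token {m} zero g 0≤g w i = trans (Σ-allConfigs-delta n m w (λ w' → g (lookup w' i))) (sym (Σ-delta (lookup w i) g))
    run-single-token {m} (suc k) g 0≤g w i = begin
        Σℚ cfg (λ w' → run M t₁ (suc k) w w' * g (lookup w' i))
          ≡⟨ run-suc k w (λ w' → g (lookup w' i)) ⟩
        Σℚ cfg (λ w'' → run M t₁ k w w'' * Σℚ cfg (λ w' → step N w'' w' * g (lookup w' i)))
          ≡⟨ Σ-cong cfg (λ w'' → cong (run M t₁ k w w'' *_) (Round.Expectation.Bounds.one-round-single-token N g 0≤g w'' i)) ⟩
        Σℚ cfg (λ w'' → run M t₁ k w w'' * g' (lookup w'' i))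
          ≡⟨ run-single-token k g' (Round.Expectation.Bounds.averaged-nonneg N g 0≤g) w i ⟩
        applyM (Mprod M t₁ k) g' (lookup w i)
          ≡⟨ sym (applyM-⊗ (Mprod M t₁ k) (matMatrix N) g (lookup w i)) ⟩
        applyM (Mprod M t₁ (suc k)) g (lookup w i) ∎
      where
      open ≡-Reasoning
      cfg : List (Config n m)
      cfg = allConfigs n m
      N : Matching G
      N = M (suc (t₁ ℕ.+ k))
      g' : Fin n → ℚ
      g' = applyM (matMatrix N) g

open import Data.Nat using (_∸_)
open import Data.Fin.Subset.Properties using (_∈?_)
open import Data.Rational.Properties using (≤-trans; ≤-reflexive)
open import Relation.Nullary using (does)
open import Relation.Binary.PropositionalEquality using (sym; trans)
open import Data.Product using (_,_)
open RationalFacts using (0≤𝟙)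
open Iteration

lemma3p2 : ∀ {n m : ℕ} (G : Graph n) (M : ℕ → Matching G) (t₁ t₂ : ℕ) → t₁ < t₂
    → (w : Config n m) (B : Subset m) (D : Subset n)
    → (PrAllIn M t₁ t₂ w B D ≤ ΠB B (λ i → rowSum (Minterval M t₁ t₂) (lookup w i) D))
    × (ΠB B (λ i → rowSum (Minterval M t₁ t₂) (lookup w i) D) ≡ ΠB B (λ i → PrIn M t₁ t₂ w i D))
lemma3p2 G M t₁ t₂ _ w B D = product-bound , single-tokens
  where
  open Rounds M t₁
  rows-as-applyM : ∀ i → rowSum (Minterval M t₁ t₂) (lookup w i) D ≡ applyM (Minterval M t₁ t₂) (λ v → 𝟙 (v ∈? D)) (lookup w i)
  rows-as-applyM i = rowSum-applyM (Minterval M t₁ t₂) (lookup w i) D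

  product-bound : PrAllIn M t₁ t₂ w B D ≤ ΠB B (λ i → rowSum (Minterval M t₁ t₂) (lookup w i) D)
  product-bound = ≤-trans (run-product-bound (λ i → does (i ∈? B)) (t₂ ∸ t₁) (λ v → 𝟙 (v ∈? D)) (λ v → 0≤𝟙 (v ∈? D)) w)
                          (≤-reflexive (sym (ΠB-cong B rows-as-applyM)))

  single-tokens : ΠB B (λ i → rowSum (Minterval M t₁ t₂) (lookup w i) D) ≡ ΠB B (λ i → PrIn M t₁ t₂ w i D)
  single-tokens = ΠB-cong B (λ i → trans (rows-as-applyM i) (sym (run-single-token (t₂ ∸ t₁) (λ v → 𝟙 (v ∈? D)) (λ v → 0≤𝟙 (v ∈? D)) w i)))
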